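{- Let $P,Q$ be integers and $p$ an odd prime such that $p\nmid P$ and $P^2-4Q$ is a quadratic nonresidue modulo $p$. Suppose that the multiplicative order of $Q$ modulo $p$ equals $\frac{p-1}{k}$ for some $k\in\{1,2\}$. Let $F=[P,Q]$, let $\pi=\pi(p)$ be its Pisano period modulo $p$, and let $\rho=\rho(p)$ be its rank of apparition modulo $p$. Then $F$ is complete modulo $p$. More precisely: (a) If $p\equiv 1\pmod 4$, or if $p\equiv 3 \pmod 4$ and $\rho$ is even, then $0$ appears in the full period $(F_1 \bmod p,\ldots,F_{\pi}\bmod p)$ exactly $p-1$ times, while each nonzero element of $\mathbb{Z}/p\mathbb{Z}$ appears exactly $\rho-1$ times. (b) If $p\equiv 3\pmod 4$ and $\rho$ is odd, then either (i) $0$ appears in the full period exactly $p-1$ times while each nonzero element of $\mathbb{Z}/p\mathbb{Z}$ appears exactly $\rho-1$ times, or (ii) $0$ appears in the full period exactly $(p-1)/2$ times while each nonzero element of $\mathbb{Z}/p\mathbb{Z}$ appears exactly $(\rho-1)/2$ times.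
   Context: $[P,Q]$ denotes the sequence $F_0=0$, $F_1=1$, $F_{n+1}=PF_n-QF_{n-1}$ ($n\ge1$). It is complete modulo $p$ if every residue class mod $p$ equals $F_n \bmod p$ for some $n\ge0$. The Pisano period $\pi(p)$ is the least positive $n$ with $F_{n+k}\equiv F_k\pmod p$ for all $k\ge 0$; the full period is the finite sequence of residues $F_1,\dots,F_{\pi(p)}$ modulo $p$ (counted with multiplicity). The rank of apparition $\rho(p)$ is the least positive integer $n$ with $F_n\equiv 0\pmod p$. -}

module Defs where

open import Data.Nat as ℕ using (ℕ; zero; suc; _<_; _∸_)
open import Data.Nat.Divisibility using (_∣?_) renaming (_∣_ to _∣ℕ_)
open import Data.Integer as ℤ using (ℤ; +_; ∣_∣)
open import Data.Product using (Σ; _×_; ∃)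
open import Relation.Nullary using (¬_; yes; no)
open import Relation.Binary.PropositionalEquality using (_≡_)

infix 4 _≡_[mod_]
_≡_[mod_] : ℤ → ℤ → ℕ → Set
a ≡ b [mod p ] = p ∣ℕ ∣ a ℤ.- b ∣

lucas : ℤ → ℤ → ℕ → ℤ
lucas P Q zero = + 0
lucas P Q (suc zero) = + 1
lucas P Q (suc (suc n)) = P ℤ.* lucas P Q (suc n) ℤ.- Q ℤ.* lucas P Q n

IsComplete : ℤ → ℤ → ℕ → Set
IsComplete P Q p = (r : ℤ) → ∃ λ n → lucas P Q n ≡ r [mod p ]

IsPeriodOf : ℤ → ℤ → ℕ → ℕ → Set
IsPeriodOf P Q p m = (k : ℕ) → lucas P Q (m ℕ.+ k) ≡ lucas P Q k [mod p ]

IsPisanoPeriod : ℤ → ℤ → ℕ → ℕ → Set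
IsPisanoPeriod P Q p π =
  0 < π × IsPeriodOf P Q p π × ((m : ℕ) → 0 < m → m < π → ¬ IsPeriodOf P Q p m)

IsRankOfApparition : ℤ → ℤ → ℕ → ℕ → Set
IsRankOfApparition P Q p ρ =
  0 < ρ × (lucas P Q ρ ≡ + 0 [mod p ]) ×
  ((m : ℕ) → 0 < m → m < ρ → ¬ (lucas P Q m ≡ + 0 [mod p ]))

IsQuadNonResidue : ℤ → ℕ → Set
IsQuadNonResidue D p = ¬ (D ≡ + 0 [mod p ]) × ¬ (∃ λ x → x ℤ.* x ≡ D [mod p ])

IsMultOrder : ℤ → ℕ → ℕ → Set
IsMultOrder a p m =
  0 < m × ((a ℤ.^ m) ≡ + 1 [mod p ]) ×
  ((j : ℕ) → 0 < j → j < m → ¬ ((a ℤ.^ j) ≡ + 1 [mod p ]))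

occurrences : ℤ → ℤ → ℕ → ℤ → ℕ → ℕ
occurrences P Q p r zero = 0
occurrences P Q p r (suc N) with p ∣? ∣ lucas P Q (suc N) ℤ.- r ∣
... | yes _ = suc (occurrences P Q p r N)
... | no _ = occurrences P Q p r N

Distribution : ℤ → ℤ → ℕ → ℕ → ℕ → ℕ → Set
Distribution P Q p π z w =
  occurrences P Q p (+ 0) π ≡ z ×
  ((r : ℕ) → 0 < r → r < p → occurrences P Q p (+ r) π ≡ w)

module Submission where

-- Let ρ be the rank of apparition and μ = F(ρ+1).  Then F(j + ρ) ≡ μ F(j),
-- so a period consists of the blocks μ^q F(1), …, μ^q F(ρ), q < s, where s
-- is the order of μ, and π = sρ.  In ℤ[√D]/p the Frobenius map gives
-- (P + √D)^p ≡ P - √D (Euler: D^h ≡ -1), whence F(p+1) ≡ 0 and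
-- F(p+2) ≡ Q; so ρ ∣ p + 1, μ^((p+1)/ρ) ≡ Q, and therefore s = 2h or s = h.
-- If s = 2h, μ is a primitive root, each orbit {μ^q c} meets every nonzero
-- class once, and the distribution is (p-1, ρ-1).  If s = h, then h and ρ
-- are odd, the orbit of c is the square class of c, and F(ρ-j) and F(j)
-- lie in opposite classes; the distribution is ((p-1)/2, (ρ-1)/2).

open import Defs

module ModularArithmetic where

  open import Level using (Level)
  open import Data.Nat as ℕ using (ℕ; zero; suc)
  open import Data.Integer as ℤ using (ℤ; +_; _+_; _*_; _-_; -_; _^_)
  import Data.Integer.Properties as ℤP
  open import Data.Integer.Divisibility.Signed
    using (divides; ∣ᵤ⇒∣; ∣⇒∣ᵤ; ∣m∣n⇒∣m+n; ∣m⇒∣-m; ∣m⇒∣m*n; ∣n⇒∣m*n)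
    renaming (_∣_ to _∣ℤ_)
  open import Data.Integer.Tactic.RingSolver using (solve-∀)
  open import Algebra.Core using (Op₂)
  open import Algebra.Definitions using (Congruent₂)
  open import Algebra.Structures using (IsCommutativeMonoid; IsCommutativeSemiring)
  open import Algebra.Structures.Biased using (isCommutativeSemiringˡ)
  open import Data.Product using (_,_)
  open import Relation.Binary.Core using (Rel)
  open import Relation.Binary.Bundles using (Setoid)
  import Relation.Binary.Reasoning.Setoid
  open import Relation.Binary.Structures using (IsEquivalence)
  open import Relation.Binary.PropositionalEquality as Eq using (_≡_; refl)

  module Coarsening {a ℓ : Level} {A : Set a} {_≈_ : Rel A ℓ} (≈-equiv : IsEquivalence _≈_) where
    open IsEquivalence ≈-equiv using (reflexive)

    coarsenCommutativeMonoid : ∀ {_∙_ : Op₂ A} {ε : A} →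
      IsCommutativeMonoid _≡_ _∙_ ε → Congruent₂ _≈_ _∙_ → IsCommutativeMonoid _≈_ _∙_ ε
    coarsenCommutativeMonoid M ∙-congruent = record
      { isMonoid = record
        { isSemigroup = record
          { isMagma = record { isEquivalence = ≈-equiv ; ∙-cong = ∙-congruent }
          ; assoc = λ x y z → reflexive (assoc x y z) }
        ; identity = (λ x → reflexive (identityˡ x)) , (λ x → reflexive (identityʳ x)) }
      ; comm = λ x y → reflexive (comm x y) }
      where open IsCommutativeMonoid M using (assoc; identityˡ; identityʳ; comm)

    coarsenCommutativeSemiring : ∀ {_+_ _*_ : Op₂ A} {0# 1# : A} →
      IsCommutativeSemiring _≡_ _+_ _*_ 0# 1# → Congruent₂ _≈_ _+_ → Congruent₂ _≈_ _*_ →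
      IsCommutativeSemiring _≈_ _+_ _*_ 0# 1#
    coarsenCommutativeSemiring S +-cong *-cong = isCommutativeSemiringˡ record
      { +-isCommutativeMonoid = coarsenCommutativeMonoid +-isCommutativeMonoid +-cong
      ; *-isCommutativeMonoid = coarsenCommutativeMonoid *-isCommutativeMonoid *-cong
      ; distribʳ = λ x y z → reflexive (distribʳ x y z)
      ; zeroˡ = λ x → reflexive (zeroˡ x) }
      where open IsCommutativeSemiring S using (+-isCommutativeMonoid; *-isCommutativeMonoid; distribʳ; zeroˡ)

  -- Congruence modulo an arbitrary natural number p, packaged as a record so
  -- that both sides are recoverable by unification.  Every ring operation of ℤ
  -- respects it; the typical proof shows that a - b is, as an integer
  -- identity, a combination of differences already known to be divisible by p.
  module Congruence (p : ℕ) where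

    infix 4 _≈_
    record _≈_ (a b : ℤ) : Set where
      constructor mod
      field divides-difference : + p ∣ℤ a - b


    fromCongruence : ∀ {a b} → a ≡ b [mod p ] → a ≈ b
    fromCongruence d = mod (∣ᵤ⇒∣ d)

    toCongruence : ∀ {a b} → a ≈ b → a ≡ b [mod p ]
    toCongruence (mod d) = ∣⇒∣ᵤ d

    private
      via : ∀ {a b x} → a - b ≡ x → + p ∣ℤ x → a ≈ b
      via refl d = mod d

      p∣0 : + p ∣ℤ + 0
      p∣0 = divides (+ 0) refl

    ≡⇒≈ : ∀ {a b} → a ≡ b → a ≈ b
    ≡⇒≈ {a} refl = via (ℤP.+-inverseʳ a) p∣0

    ≈-refl : ∀ {a} → a ≈ a
    ≈-refl = ≡⇒≈ refl

    ≈-sym : ∀ {a b} → a ≈ b → b ≈ a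
    ≈-sym {a} {b} (mod d) = via (lemma a b) (∣m⇒∣-m d)
      where lemma : ∀ a b → b - a ≡ - (a - b)
            lemma = solve-∀

    ≈-trans : ∀ {a b c} → a ≈ b → b ≈ c → a ≈ c
    ≈-trans {a} {b} {c} (mod d) (mod e) = via (lemma a b c) (∣m∣n⇒∣m+n d e)
      where lemma : ∀ a b c → a - c ≡ (a - b) + (b - c)
            lemma = solve-∀

    ≈-isEquivalence : IsEquivalence _≈_
    ≈-isEquivalence = record { refl = ≈-refl ; sym = ≈-sym ; trans = ≈-trans }

    ≈-setoid : Setoid _ _
    ≈-setoid = record { isEquivalence = ≈-isEquivalence }

    module ≈-Reasoning = Relation.Binary.Reasoning.Setoid ≈-setoid

    +-cong : ∀ {a b c d} → a ≈ b → c ≈ d → a + c ≈ b + d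
    +-cong {a} {b} {c} {d} (mod x) (mod y) = via (lemma a b c d) (∣m∣n⇒∣m+n x y)
      where lemma : ∀ a b c d → (a + c) - (b + d) ≡ (a - b) + (c - d)
            lemma = solve-∀

    neg-cong : ∀ {a b} → a ≈ b → - a ≈ - b
    neg-cong {a} {b} (mod x) = via (lemma a b) (∣m⇒∣-m x)
      where lemma : ∀ a b → - a - - b ≡ - (a - b)
            lemma = solve-∀

    neg-injective : ∀ {a b} → - a ≈ - b → a ≈ b
    neg-injective {a} {b} -a≈-b = Eq.subst₂ _≈_ (ℤP.neg-involutive a) (ℤP.neg-involutive b) (neg-cong -a≈-b)

    -‿cong : ∀ {a b c d} → a ≈ b → c ≈ d → a - c ≈ b - d
    -‿cong x y = +-cong x (neg-cong y)

    *-cong : ∀ {a b c d} → a ≈ b → c ≈ d → a * c ≈ b * d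
    *-cong {a} {b} {c} {d} (mod x) (mod y) = via (lemma a b c d) (∣m∣n⇒∣m+n (∣m⇒∣m*n c x) (∣n⇒∣m*n b y))
      where lemma : ∀ a b c d → a * c - b * d ≡ (a - b) * c + b * (c - d)
            lemma = solve-∀

    *-congˡ : ∀ c {a b} → a ≈ b → c * a ≈ c * b
    *-congˡ c = *-cong (≈-refl {c})

    *-congʳ : ∀ c {a b} → a ≈ b → a * c ≈ b * c
    *-congʳ c x = *-cong x (≈-refl {c})

    ^-cong : ∀ n {a b} → a ≈ b → a ^ n ≈ b ^ n
    ^-cong zero    x = ≈-refl
    ^-cong (suc n) x = *-cong x (^-cong n x)

    multiple≈0 : ∀ k → k * + p ≈ + 0
    multiple≈0 k = via (ℤP.+-identityʳ (k * + p)) (divides k refl)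

    ℤmod-isCommutativeSemiring : IsCommutativeSemiring _≈_ _+_ _*_ (+ 0) (+ 1)
    ℤmod-isCommutativeSemiring =
      coarsenCommutativeSemiring ℤP.+-*-isCommutativeSemiring +-cong *-cong
      where open Coarsening ≈-isEquivalence

module PrimeModuli where

  open ModularArithmetic
  open import Data.Nat as ℕ using (ℕ; zero; suc; s≤s; NonZero)
  import Data.Nat.Properties as ℕP
  import Data.Nat.Divisibility as ℕD
  open import Data.Nat.Primality using (Prime; euclidsLemma; prime⇒nonZero; prime⇒nonTrivial)
  open import Data.Integer as ℤ using (ℤ; +_; _+_; _*_; _-_; -_; _^_; ∣_∣)
  import Data.Integer.Properties as ℤP
  import Data.Integer.DivMod as ℤDM
  open import Data.Integer.Divisibility.Signed using (∣ᵤ⇒∣; ∣⇒∣ᵤ)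
  open import Data.Integer.Tactic.RingSolver using (solve-∀)
  open import Data.Sum using (_⊎_; inj₁; inj₂; [_,_]′)
  import Data.Sum
  open import Data.Empty using (⊥-elim)
  open import Relation.Nullary using (¬_)
  open import Relation.Binary.PropositionalEquality as Eq using (_≡_; refl; subst)

  module PrimeModulus (p : ℕ) (p-prime : Prime p) where

    open Congruence p public
    open ≈-Reasoning

    instance
      p-nonZero : NonZero p
      p-nonZero = prime⇒nonZero p-prime

    1<p : 1 ℕ.< p
    1<p = ℕ.nonTrivial⇒n>1 p {{prime⇒nonTrivial p-prime}}

    ≈0⇒∣ : ∀ {a} → a ≈ + 0 → p ℕD.∣ ∣ a ∣
    ≈0⇒∣ {a} (mod d) = subst (λ x → p ℕD.∣ ∣ x ∣) (ℤP.+-identityʳ a) (∣⇒∣ᵤ d)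

    ∣⇒≈0 : ∀ {a} → p ℕD.∣ ∣ a ∣ → a ≈ + 0
    ∣⇒≈0 {a} d = mod (∣ᵤ⇒∣ (subst (λ x → p ℕD.∣ ∣ x ∣) (Eq.sym (ℤP.+-identityʳ a)) d))

    ≈⇒difference≈0 : ∀ {a b} → a ≈ b → a - b ≈ + 0
    ≈⇒difference≈0 {a} {b} a≈b = begin
      a - b ≈⟨ -‿cong a≈b (≈-refl {b}) ⟩
      b - b ≡⟨ ℤP.+-inverseʳ b ⟩
      + 0   ∎

    difference≈0⇒≈ : ∀ {a b} → a - b ≈ + 0 → a ≈ b
    difference≈0⇒≈ {a} {b} d = begin
      a           ≡⟨ lemma a b ⟩
      (a - b) + b ≈⟨ +-cong d (≈-refl {b}) ⟩
      + 0 + b     ≡⟨ ℤP.+-identityˡ b ⟩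
      b           ∎
      where lemma : ∀ a b → a ≡ (a - b) + b
            lemma = solve-∀

    small-injective : ∀ {m n} → m ℕ.< p → n ℕ.< p → + m ≈ + n → m ≡ n
    small-injective {m} {n} m<p n<p m≈n = ℤP.+-injective (ℤP.i-j≡0⇒i≡j (+ m) (+ n) (ℤP.∣i∣≡0⇒i≡0 distance≡0))
      where
      distance≡0 : ∣ + m - + n ∣ ≡ 0
      distance≡0 with ∣ + m - + n ∣ in eq | ≈0⇒∣ (≈⇒difference≈0 m≈n)
      ... | zero  | _ = refl
      ... | suc d | p∣ = ⊥-elim (ℕD.>⇒∤ (ℕP.≤-<-trans bound (ℕP.⊔-pres-<m m<p n<p)) p∣)
        where bound : suc d ℕ.≤ m ℕ.⊔ n
              bound = subst (ℕ._≤ m ℕ.⊔ n) eq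
                        (subst (λ x → ∣ x ∣ ℕ.≤ m ℕ.⊔ n) (Eq.sym (ℤP.m-n≡m⊖n m n)) (ℤP.∣m⊝n∣≤m⊔n m n))

    small-nonzero : ∀ {n} → 0 ℕ.< n → n ℕ.< p → ¬ + n ≈ + 0
    small-nonzero 0<n n<p n≈0 = ℕP.<⇒≢ 0<n (Eq.sym (small-injective n<p (ℕP.<-trans ℕ.z<s 1<p) n≈0))

    1+i<p : ∀ {i} → i ℕ.< p ℕ.∸ 1 → suc i ℕ.< p
    1+i<p i<p-1 = ℕP.≤-trans (s≤s i<p-1) (ℕP.≤-reflexive (ℕP.suc-pred p))

    1≉0 : ¬ + 1 ≈ + 0
    1≉0 = small-nonzero ℕ.z<s 1<p

    residue : ℤ → ℕ
    residue a = a ℤDM.%ℕ p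

    residue<p : ∀ a → residue a ℕ.< p
    residue<p a = ℤDM.n%ℕd<d a p

    ≈residue : ∀ a → a ≈ + residue a
    ≈residue a = begin
      a                                        ≡⟨ ℤDM.a≡a%ℕn+[a/ℕn]*n a p ⟩
      + residue a + (a ℤDM./ℕ p) * + p         ≈⟨ +-cong (≈-refl {+ residue a}) (multiple≈0 (a ℤDM./ℕ p)) ⟩
      + residue a + + 0                        ≡⟨ ℤP.+-identityʳ (+ residue a) ⟩
      + residue a                              ∎

    zero-product : ∀ {a b} → a * b ≈ + 0 → a ≈ + 0 ⊎ b ≈ + 0
    zero-product {a} {b} ab≈0 with euclidsLemma ∣ a ∣ ∣ b ∣ p-prime (subst (p ℕD.∣_) (ℤP.abs-* a b) (≈0⇒∣ ab≈0))
    ... | inj₁ p∣a = inj₁ (∣⇒≈0 p∣a)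
    ... | inj₂ p∣b = inj₂ (∣⇒≈0 p∣b)

    nonzero-* : ∀ {a b} → ¬ a ≈ + 0 → ¬ b ≈ + 0 → ¬ a * b ≈ + 0
    nonzero-* a≉0 b≉0 ab≈0 = [ a≉0 , b≉0 ]′ (zero-product ab≈0)

    nonzero-^ : ∀ {a} n → ¬ a ≈ + 0 → ¬ a ^ n ≈ + 0
    nonzero-^ zero    a≉0 = 1≉0
    nonzero-^ (suc n) a≉0 = nonzero-* a≉0 (nonzero-^ n a≉0)

    nonzero-neg : ∀ {a} → ¬ a ≈ + 0 → ¬ - a ≈ + 0
    nonzero-neg {a} a≉0 -a≈0 = a≉0 (begin
      a     ≡⟨ ℤP.neg-involutive a ⟨
      - - a ≈⟨ neg-cong -a≈0 ⟩
      + 0   ∎)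

    cancelˡ : ∀ {c x y} → ¬ c ≈ + 0 → c * x ≈ c * y → x ≈ y
    cancelˡ {c} {x} {y} c≉0 cx≈cy = [ (λ c≈0 → ⊥-elim (c≉0 c≈0)) , difference≈0⇒≈ ]′ (zero-product c[x-y]≈0)
      where
      c[x-y]≈0 : c * (x - y) ≈ + 0
      c[x-y]≈0 = begin
        c * (x - y)   ≡⟨ lemma c x y ⟩
        c * x - c * y ≈⟨ ≈⇒difference≈0 cx≈cy ⟩
        + 0           ∎
        where lemma : ∀ c x y → c * (x - y) ≡ c * x - c * y
              lemma = solve-∀

    -- Equal squares have equal or opposite roots, since x² - y² = (x - y)(x + y).
    ≈-on-squares : ∀ {x y} → x * x ≈ y * y → x ≈ y ⊎ x ≈ - y
    ≈-on-squares {x} {y} x²≈y² = Data.Sum.map difference≈0⇒≈ difference≈0⇒≈ (zero-product factorised)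
      where
      factorised : (x - y) * (x - - y) ≈ + 0
      factorised = begin
        (x - y) * (x - - y) ≡⟨ lemma x y ⟩
        x * x - y * y       ≈⟨ ≈⇒difference≈0 x²≈y² ⟩
        + 0                 ∎
        where lemma : ∀ x y → (x - y) * (x - - y) ≡ x * x - y * y
              lemma = solve-∀

    square≈1 : ∀ {x} → x * x ≈ + 1 → x ≈ + 1 ⊎ x ≈ - + 1
    square≈1 x²≈1 = ≈-on-squares (≈-trans x²≈1 (≡⇒≈ refl))

    -- For odd p, 2 is invertible, so no nonzero element equals its negative.
    module OddModulus (2<p : 2 ℕ.< p) where

      2≉0 : ¬ + 2 ≈ + 0
      2≉0 = small-nonzero ℕ.z<s 2<p

      ≈-self-negation : ∀ {a} → a ≈ - a → a ≈ + 0
      ≈-self-negation {a} a≈-a = [ (λ 2≈0 → ⊥-elim (2≉0 2≈0)) , (λ a≈0 → a≈0) ]′ (zero-product 2a≈0)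
        where
        2a≈0 : + 2 * a ≈ + 0
        2a≈0 = begin
          + 2 * a ≡⟨ lemma a ⟩
          a + a   ≈⟨ +-cong a≈-a (≈-refl {a}) ⟩
          - a + a ≡⟨ ℤP.+-inverseˡ a ⟩
          + 0     ∎
          where lemma : ∀ a → + 2 * a ≡ a + a
                lemma = solve-∀

      1≉-1 : ¬ + 1 ≈ - + 1
      1≉-1 1≈-1 = 1≉0 (≈-self-negation 1≈-1)

module BinomialsAndFrobenius where

  open import Data.Nat as ℕ using (ℕ; zero; suc; z≤n; s≤s)
  import Data.Nat.Properties as ℕP
  import Data.Nat.Divisibility as ℕD
  open import Data.Nat.Combinatorics using (_C_; nCn≡1; nC1≡n; nCk+nC[k+1]≡[n+1]C[k+1]; k>n⇒nCk≡0)
  open import Data.Nat.Primality using (Prime; euclidsLemma; prime⇒nonTrivial)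
  open import Data.Nat.Solver using (module +-*-Solver)
  open import Data.Fin as Fin using (Fin; toℕ; fromℕ; inject₁)
  import Data.Fin.Properties as FinP
  open import Data.Sum using (inj₁; inj₂)
  open import Data.Empty using (⊥-elim)
  open import Relation.Binary.PropositionalEquality as Eq using (_≡_; refl; cong; cong₂)
  open import Algebra.Bundles using (CommutativeSemiring)
  import Level

  absorption : ∀ n k → suc k ℕ.* (suc n C suc k) ≡ suc n ℕ.* (n C k)
  absorption zero    zero    = refl
  absorption zero    (suc k) = Eq.trans (cong (suc (suc k) ℕ.*_) (k>n⇒nCk≡0 {1} {suc (suc k)} (s≤s (s≤s z≤n)))) (ℕP.*-zeroʳ (suc (suc k)))
  absorption (suc n) zero    = Eq.trans (ℕP.+-identityʳ _) (Eq.trans (nC1≡n (suc (suc n))) (Eq.sym (ℕP.*-identityʳ (suc (suc n)))))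
  absorption (suc n) (suc k) = begin
      suc (suc k) ℕ.* (suc (suc n) C suc (suc k))
    ≡⟨ cong (suc (suc k) ℕ.*_) (nCk+nC[k+1]≡[n+1]C[k+1] (suc n) (suc k)) ⟨
      suc (suc k) ℕ.* (A ℕ.+ B)
    ≡⟨ solve 3 (λ k A B → (con 2 :+ k) :* (A :+ B) := ((con 1 :+ k) :* A :+ A) :+ (con 2 :+ k) :* B) refl k A B ⟩
      (suc k ℕ.* A ℕ.+ A) ℕ.+ suc (suc k) ℕ.* B
    ≡⟨ cong₂ (λ u v → (u ℕ.+ A) ℕ.+ v) (absorption n k) (absorption n (suc k)) ⟩
      (suc n ℕ.* (n C k) ℕ.+ A) ℕ.+ suc n ℕ.* (n C suc k)
    ≡⟨ solve 4 (λ n a b A → (n :* a :+ A) :+ n :* b := n :* (a :+ b) :+ A) refl (suc n) (n C k) (n C suc k) A ⟩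
      suc n ℕ.* (n C k ℕ.+ n C suc k) ℕ.+ A
    ≡⟨ cong (λ z → suc n ℕ.* z ℕ.+ A) (nCk+nC[k+1]≡[n+1]C[k+1] n k) ⟩
      suc n ℕ.* A ℕ.+ A
    ≡⟨ ℕP.+-comm (suc n ℕ.* A) A ⟩
      suc (suc n) ℕ.* A
    ∎
    where
    open Eq.≡-Reasoning
    open +-*-Solver using (solve; _:+_; _:*_; _:=_; con)
    A B : ℕ
    A = suc n C suc k
    B = suc n C suc (suc k)

  -- A prime p divides every inner binomial coefficient C(p,k), 0 < k < p:
  -- it divides k·C(p,k) = p·C(p-1,k-1) but not k.
  prime∣binomial : ∀ {p} → Prime p → ∀ k → 0 ℕ.< k → k ℕ.< p → p ℕD.∣ (p C k)
  prime∣binomial {suc p-1} p-prime (suc k) _ k<p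
    with euclidsLemma (suc k) (suc p-1 C suc k) p-prime
           (ℕD.divides (p-1 C k) (Eq.trans (absorption p-1 k) (ℕP.*-comm (suc p-1) (p-1 C k))))
  ... | inj₂ p∣C = p∣C
  ... | inj₁ p∣k = ⊥-elim (ℕP.<⇒≱ k<p (ℕD.∣⇒≤ p∣k))

  -- The Frobenius map x ↦ x^p is additive in every commutative semiring of
  -- prime characteristic p: in the binomial expansion of (x + y)^p all inner
  -- terms are multiples of p.
  module Frobenius {c ℓ} (R : CommutativeSemiring c ℓ) where

    open CommutativeSemiring R hiding (refl)
    open import Algebra.Definitions.RawMonoid +-rawMonoid using (_×_; sum)
    open import Algebra.Definitions.RawSemiring rawSemiring using (_^_)
    open import Algebra.Properties.CommutativeSemiring.Binomial R using (theorem; binomialTerm)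
    open import Algebra.Properties.Monoid.Mult +-monoid using (×-assocˡ; ×-homo-1; ×-congʳ)
    open import Algebra.Properties.Monoid.Sum +-monoid using (sum-init-last; sum-cong-≋; sum-replicate; sum-replicate-zero)
    open import Relation.Binary.Reasoning.Setoid setoid
    open import Data.Vec.Functional using (Vector; init; last; tail)

    HasCharacteristic : ℕ → Set (c Level.⊔ ℓ)
    HasCharacteristic n = ∀ x → n × x ≈ 0#

    ×0# : ∀ q → q × 0# ≈ 0#
    ×0# q = trans (sym (sum-replicate q)) (sum-replicate-zero q)

    multiple-of-characteristic : ∀ {n k} → HasCharacteristic n → n ℕD.∣ k → ∀ x → k × x ≈ 0#
    multiple-of-characteristic {n} char (ℕD.divides q refl) x = begin
      (q ℕ.* n) × x ≈⟨ ×-assocˡ x q n ⟨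
      q × (n × x)   ≈⟨ ×-congʳ q (char x) ⟩
      q × 0#        ≈⟨ ×0# q ⟩
      0#            ∎

    private
      termAt : ∀ x y n (k : Fin (suc n)) j → toℕ k ≡ j →
               binomialTerm x y n k ≡ (n C j) × (x ^ j * y ^ (n ℕ.∸ j))
      termAt x y n k j refl = refl

      frobenius-2+ : ∀ m → Prime (2 ℕ.+ m) → HasCharacteristic (2 ℕ.+ m) →
                     ∀ x y → (x + y) ^ (2 ℕ.+ m) ≈ x ^ (2 ℕ.+ m) + y ^ (2 ℕ.+ m)
      frobenius-2+ m p-prime char x y = begin
        (x + y) ^ p                                            ≈⟨ theorem p x y ⟩
        t Fin.zero + sum (tail t)                              ≈⟨ +-congˡ (sum-init-last (tail t)) ⟩
        t Fin.zero + (sum (init (tail t)) + last (tail t))     ≈⟨ +-cong first (+-cong (trans (sum-cong-≋ inner) (sum-replicate-zero (suc m))) final) ⟩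
        y ^ p + (0# + x ^ p)                                   ≈⟨ +-congˡ (+-identityˡ _) ⟩
        y ^ p + x ^ p                                          ≈⟨ +-comm _ _ ⟩
        x ^ p + y ^ p                                          ∎
        where
        p = 2 ℕ.+ m
        t = binomialTerm x y p
        first : t Fin.zero ≈ y ^ p
        first = trans (×-homo-1 _) (*-identityˡ _)
        final : last (tail t) ≈ x ^ p
        final = begin
          last (tail t)                      ≡⟨ termAt x y p (Fin.suc (fromℕ (suc m))) p (cong suc (FinP.toℕ-fromℕ (suc m))) ⟩
          (p C p) × (x ^ p * y ^ (p ℕ.∸ p))  ≡⟨ cong₂ _×_ (nCn≡1 p) (cong (λ z → x ^ p * y ^ z) (ℕP.n∸n≡0 p)) ⟩
          1 × (x ^ p * 1#)                   ≈⟨ ×-homo-1 _ ⟩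
          x ^ p * 1#                         ≈⟨ *-identityʳ _ ⟩
          x ^ p                              ∎
        inner : ∀ i → init (tail t) i ≈ 0#
        inner i = begin
          init (tail t) i         ≡⟨ termAt x y p (Fin.suc (inject₁ i)) (suc (toℕ i)) (cong suc (FinP.toℕ-inject₁ i)) ⟩
          (p C suc (toℕ i)) × _   ≈⟨ multiple-of-characteristic char (prime∣binomial p-prime (suc (toℕ i)) (s≤s z≤n) (s≤s (FinP.toℕ<n i))) _ ⟩
          0#                      ∎

    frobenius : ∀ {p} → Prime p → HasCharacteristic p → ∀ x y → (x + y) ^ p ≈ x ^ p + y ^ p
    frobenius {suc (suc m)} = frobenius-2+ m
    frobenius {0}           p-prime = ⊥-elim (ℕ.NonTrivial.nonTrivial (prime⇒nonTrivial p-prime))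
    frobenius {1}           p-prime = ⊥-elim (ℕ.NonTrivial.nonTrivial (prime⇒nonTrivial p-prime))

module FermatAndEuler where

  open PrimeModuli
  open BinomialsAndFrobenius
  open import Data.Nat as ℕ using (ℕ; zero; suc; z≤n; s≤s)
  import Data.Nat.Properties as ℕP
  open import Data.Nat.Primality using (Prime)
  open import Data.Integer as ℤ using (ℤ; +_; _+_; _*_; _-_; -_; _^_)
  import Data.Integer.Properties as ℤP
  open import Data.Integer.Tactic.RingSolver using (solve-∀)
  open import Data.List using (List; []; _∷_; length; replicate; applyUpTo)
  import Data.List.Properties as ListP
  open import Data.List.Relation.Unary.All using (All; []; _∷_)
  import Data.List.Relation.Unary.All as All
  import Data.List.Relation.Unary.All.Properties as AllP
  open import Data.List.Relation.Unary.AllPairs using (AllPairs; []; _∷_)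
  import Data.List.Relation.Unary.AllPairs.Properties as AllPairsP
  open import Data.Product using (_,_)
  open import Data.Sum using ([_,_]′)
  open import Data.Empty using (⊥-elim)
  open import Relation.Nullary using (¬_)
  open import Relation.Binary.PropositionalEquality as Eq using (_≡_; refl; cong; subst; subst₂)
  open import Algebra.Bundles using (CommutativeSemiring)

  ^-*-distribʳ : ∀ a b n → (a * b) ^ n ≡ a ^ n * b ^ n
  ^-*-distribʳ a b zero    = refl
  ^-*-distribʳ a b (suc n) = Eq.trans (cong ((a * b) *_) (^-*-distribʳ a b n)) (lemma a b (a ^ n) (b ^ n))
    where lemma : ∀ a b c d → a * b * (c * d) ≡ a * c * (b * d)
          lemma = solve-∀

  neg-power : ∀ x n → (- x) ^ n ≡ (- + 1) ^ n * x ^ n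
  neg-power x n = Eq.trans (cong (_^ n) (lemma x)) (^-*-distribʳ (- + 1) x n)
    where lemma : ∀ x → - x ≡ - + 1 * x
          lemma = solve-∀

  -1^even : ∀ k → (- + 1) ^ (k ℕ.* 2) ≡ + 1
  -1^even zero    = refl
  -1^even (suc k) = cong (λ z → - + 1 * (- + 1 * z)) (-1^even k)

  -1^odd : ∀ k → (- + 1) ^ suc (k ℕ.* 2) ≡ - + 1
  -1^odd k = cong (- + 1 *_) (-1^even k)

  ^-*-comm : ∀ a m n → (a ^ m) ^ n ≡ (a ^ n) ^ m
  ^-*-comm a m n = Eq.trans (ℤP.^-*-assoc a m n) (Eq.trans (cong (a ^_) (ℕP.*-comm m n)) (Eq.sym (ℤP.^-*-assoc a n m)))

  -- Fermat's little theorem, from the Frobenius identity in ℤ/p: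
  -- (n + 1)^p ≡ n^p + 1, so n^p ≡ n by induction on n.
  module Fermat (p : ℕ) (p-prime : Prime p) where

    open PrimeModulus p p-prime
    open ≈-Reasoning

    ℤmod : CommutativeSemiring _ _
    ℤmod = record { isCommutativeSemiring = ℤmod-isCommutativeSemiring }

    open Frobenius ℤmod using (HasCharacteristic; frobenius)
    open import Algebra.Definitions.RawMonoid (CommutativeSemiring.+-rawMonoid ℤmod) using (_×_)
    open import Algebra.Definitions.RawSemiring (CommutativeSemiring.rawSemiring ℤmod) using () renaming (_^_ to _^ₛ_)

    ^ₛ≡^ : ∀ a n → a ^ₛ n ≡ a ^ n
    ^ₛ≡^ a zero    = refl
    ^ₛ≡^ a (suc n) = cong (a *_) (^ₛ≡^ a n)

    ×≡* : ∀ n a → n × a ≡ + n * a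
    ×≡* zero    a = Eq.sym (ℤP.*-zeroˡ a)
    ×≡* (suc n) a = Eq.trans (cong (λ x → a + x) (×≡* n a)) (lemma a (+ n))
      where lemma : ∀ a n → a + n * a ≡ (+ 1 + n) * a
            lemma = solve-∀

    characteristic : HasCharacteristic p
    characteristic a = begin
      p × a   ≡⟨ ×≡* p a ⟩
      + p * a ≡⟨ ℤP.*-comm (+ p) a ⟩
      a * + p ≈⟨ multiple≈0 a ⟩
      + 0     ∎

    fermat-ℕ : ∀ n → (+ n) ^ p ≈ + n
    fermat-ℕ zero    = ≡⇒≈ (Eq.trans (cong ((+ 0) ^_) (Eq.sym (ℕP.suc-pred p))) (ℤP.*-zeroˡ ((+ 0) ^ (p ℕ.∸ 1))))
    fermat-ℕ (suc n) = begin
      (+ 1 + + n) ^ p          ≡⟨ ^ₛ≡^ (+ 1 + + n) p ⟨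
      (+ 1 + + n) ^ₛ p         ≈⟨ frobenius p-prime characteristic (+ 1) (+ n) ⟩
      (+ 1) ^ₛ p + (+ n) ^ₛ p  ≡⟨ Eq.cong₂ _+_ (Eq.trans (^ₛ≡^ (+ 1) p) (ℤP.^-zeroˡ p)) (^ₛ≡^ (+ n) p) ⟩
      + 1 + (+ n) ^ p          ≈⟨ +-cong (≈-refl {+ 1}) (fermat-ℕ n) ⟩
      + 1 + + n                ∎

    fermat-^p : ∀ a → a ^ p ≈ a
    fermat-^p a = begin
      a ^ p                ≈⟨ ^-cong p (≈residue a) ⟩
      (+ residue a) ^ p    ≈⟨ fermat-ℕ (residue a) ⟩
      + residue a          ≈⟨ ≈-sym (≈residue a) ⟩
      a                    ∎

    fermat : ∀ {a} → ¬ a ≈ + 0 → a ^ (p ℕ.∸ 1) ≈ + 1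
    fermat {a} a≉0 = cancelˡ a≉0 (begin
      a * a ^ (p ℕ.∸ 1) ≡⟨ cong (a ^_) (ℕP.suc-pred p) ⟩
      a ^ p             ≈⟨ fermat-^p a ⟩
      a                 ≡⟨ ℤP.*-identityʳ a ⟨
      a * + 1           ∎)

  -- Monic integer polynomials, given by their lower coefficients:
  -- monic (c₀ ∷ c₁ ∷ … ∷ c_{d-1} ∷ []) x = c₀ + x (c₁ + x (… + x · 1)).
  monic : List ℤ → ℤ → ℤ
  monic []       x = + 1
  monic (c ∷ cs) x = c + x * monic cs x

  -- Synthetic division by x - a: the (monic) quotient of  monic (c ∷ cs).
  divide : List ℤ → ℤ → List ℤ
  divide []       a = []
  divide (c ∷ cs) a = monic (c ∷ cs) a ∷ divide cs a

  length-divide : ∀ cs a → length (divide cs a) ≡ length cs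
  length-divide []       a = refl
  length-divide (c ∷ cs) a = cong suc (length-divide cs a)

  factor-theorem : ∀ c cs a x → monic (c ∷ cs) x ≡ (x - a) * monic (divide cs a) x + monic (c ∷ cs) a
  factor-theorem c []        a x = lemma c a x
    where lemma : ∀ c a x → c + x * + 1 ≡ (x - a) * + 1 + (c + a * + 1)
          lemma = solve-∀
  factor-theorem c (c′ ∷ cs) a x =
    Eq.trans (cong (λ z → c + x * z) (factor-theorem c′ cs a x))
             (lemma c x a (monic (divide cs a) x) (monic (c′ ∷ cs) a))
    where lemma : ∀ c x a q r → c + x * ((x - a) * q + r) ≡ (x - a) * (r + x * q) + (c + a * r)
          lemma = solve-∀

  monic-xᵏ : ∀ k x → monic (replicate k (+ 0)) x ≡ x ^ k
  monic-xᵏ zero    x = refl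
  monic-xᵏ (suc k) x = Eq.trans (ℤP.+-identityˡ _) (cong (x *_) (monic-xᵏ k x))

  module RootBound (p : ℕ) (p-prime : Prime p) where

    open PrimeModulus p p-prime
    open ≈-Reasoning

    Distinct : List ℤ → Set
    Distinct = AllPairs (λ u v → ¬ u ≈ v)

    IsRootOf : List ℤ → ℤ → Set
    IsRootOf f r = monic f r ≈ + 0

    -- Over the field ℤ/p a monic polynomial of degree d has at most d roots:
    -- the roots other than a of f are roots of the quotient of f by x - a.
    root-bound : ∀ f rs → Distinct rs → All (IsRootOf f) rs → length rs ℕ.≤ length f
    root-bound []       []       _            _             = z≤n
    root-bound []       (r ∷ rs) _            (1≈0 ∷ _)     = ⊥-elim (1≉0 1≈0)
    root-bound (c ∷ cs) []       _            _             = z≤n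
    root-bound (c ∷ cs) (a ∷ rs) (a∉rs ∷ rs!) (fa≈0 ∷ fr≈0) =
      s≤s (subst (length rs ℕ.≤_) (length-divide cs a)
            (root-bound (divide cs a) rs rs! (All.zipWith (λ (b≉a , fb≈0) → quotient-root b≉a fb≈0) (a∉rs , fr≈0))))
      where
      quotient-root : ∀ {b} → ¬ a ≈ b → IsRootOf (c ∷ cs) b → IsRootOf (divide cs a) b
      quotient-root {b} a≉b fb≈0 = cancelˡ b-a≉0 (begin
        (b - a) * monic (divide cs a) b                                       ≡⟨ lemma _ _ ⟩
        ((b - a) * monic (divide cs a) b + monic (c ∷ cs) a) - monic (c ∷ cs) a ≡⟨ cong (_- monic (c ∷ cs) a) (factor-theorem c cs a b) ⟨
        monic (c ∷ cs) b - monic (c ∷ cs) a                                   ≈⟨ -‿cong fb≈0 fa≈0 ⟩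
        + 0 - + 0                                                             ≡⟨ ℤP.*-zeroʳ (b - a) ⟨
        (b - a) * + 0                                                         ∎)
        where
        lemma : ∀ u w → u ≡ (u + w) - w
        lemma = solve-∀
        b-a≉0 : ¬ b - a ≈ + 0
        b-a≉0 b-a≈0 = a≉b (≈-sym (difference≈0⇒≈ b-a≈0))

  -- Euler's criterion for nonresidues, p = 2h + 1: the h distinct squares
  -- 1², …, h² are roots of xʰ - 1, so a nonresidue D cannot be one as well;
  -- since (Dʰ)² = D^(p-1) ≡ 1, this forces Dʰ ≡ -1.
  module EulerCriterion (p : ℕ) (p-prime : Prime p) (h : ℕ) (p≡2h+1 : p ≡ suc (h ℕ.+ h)) where

    open PrimeModulus p p-prime
    open Fermat p p-prime using (fermat)
    open RootBound p p-prime
    open ≈-Reasoning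

    p-1≡h+h : p ℕ.∸ 1 ≡ h ℕ.+ h
    p-1≡h+h = cong ℕ.pred p≡2h+1

    square-of-power : ∀ x → (x ^ h) * (x ^ h) ≡ x ^ (p ℕ.∸ 1)
    square-of-power x = Eq.trans (Eq.sym (ℤP.^-distribˡ-+-* x h h)) (cong (x ^_) (Eq.sym p-1≡h+h))

    base<p : ∀ {i} → i ℕ.< h → suc i ℕ.< p
    base<p {i} i<h = subst (suc i ℕ.<_) (Eq.sym p≡2h+1) (s≤s (ℕP.≤-trans i<h (ℕP.m≤m+n h h)))

    -- The squares 1², …, h² are pairwise incongruent (i² ≡ j² forces
    -- i ≡ ±j, impossible for 0 < i, j ≤ h as then 0 < i + j < p).
    squares : List ℤ
    squares = applyUpTo (λ i → + suc i * + suc i) h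

    squares-distinct : Distinct squares
    squares-distinct = AllPairsP.applyUpTo⁺₁ _ h distinct
      where
      distinct : ∀ {i j} → i ℕ.< j → j ℕ.< h → ¬ + suc i * + suc i ≈ + suc j * + suc j
      distinct {i} {j} i<j j<h sq = [ equal , opposite ]′ (≈-on-squares {+ suc i} {+ suc j} sq)
        where
        equal : ¬ + suc i ≈ + suc j
        equal i≈j = ℕP.<⇒≢ (s≤s i<j) (small-injective (base<p (ℕP.<-trans i<j j<h)) (base<p j<h) i≈j)
        opposite : ¬ + suc i ≈ - + suc j
        opposite i≈-j = small-nonzero {suc i ℕ.+ suc j} ℕ.z<s sum<p (begin
          + suc i + + suc j     ≈⟨ +-cong i≈-j (≈-refl {+ suc j}) ⟩
          - + suc j + + suc j   ≡⟨ ℤP.+-inverseˡ (+ suc j) ⟩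
          + 0                   ∎)
          where
          sum<p : suc i ℕ.+ suc j ℕ.< p
          sum<p = subst (suc i ℕ.+ suc j ℕ.<_) (Eq.sym p≡2h+1) (s≤s (ℕP.+-mono-≤ (ℕP.<-trans i<j j<h) j<h))

    power-h² : ∀ {x} → ¬ x ≈ + 0 → (x ^ h) * (x ^ h) ≈ + 1
    power-h² {x} x≉0 = ≈-trans (≡⇒≈ (square-of-power x)) (fermat x≉0)

    0<h : 0 ℕ.< h
    0<h = ℕP.n≢0⇒n>0 λ h≡0 → ℕP.<-irrefl (Eq.sym (Eq.trans p≡2h+1 (cong (λ n → suc (n ℕ.+ n)) h≡0))) 1<p

    h≡1+[h-1] : h ≡ suc (ℕ.pred h)
    h≡1+[h-1] = Eq.sym (ℕP.suc-pred h {{ℕ.>-nonZero 0<h}})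

    2<p : 2 ℕ.< p
    2<p = subst (2 ℕ.<_) (Eq.sym p≡2h+1) (s≤s (ℕP.+-mono-≤ 0<h 0<h))

    xʰ-1 : List ℤ
    xʰ-1 = - + 1 ∷ replicate (ℕ.pred h) (+ 0)

    root-of-xʰ-1 : ∀ {x} → x ^ h ≈ + 1 → IsRootOf xʰ-1 x
    root-of-xʰ-1 {x} xʰ≈1 = begin
      - + 1 + x * monic (replicate (ℕ.pred h) (+ 0)) x ≡⟨ cong (λ z → - + 1 + x * z) (monic-xᵏ (ℕ.pred h) x) ⟩
      - + 1 + x ^ suc (ℕ.pred h)                        ≡⟨ cong (λ n → - + 1 + x ^ n) h≡1+[h-1] ⟨
      - + 1 + x ^ h                                     ≈⟨ +-cong (≈-refl { - + 1}) xʰ≈1 ⟩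
      + 0                                               ∎

    squares-are-roots : All (IsRootOf xʰ-1) squares
    squares-are-roots = AllP.applyUpTo⁺₁ _ h λ {i} i<h → root-of-xʰ-1 (begin
      (+ suc i * + suc i) ^ h        ≡⟨ ^-*-distribʳ (+ suc i) (+ suc i) h ⟩
      (+ suc i) ^ h * (+ suc i) ^ h  ≈⟨ power-h² (small-nonzero ℕ.z<s (base<p i<h)) ⟩
      + 1                            ∎)

    nonresidue-power : ∀ {D} → IsQuadNonResidue D p → D ^ h ≈ - + 1
    nonresidue-power {D} (D≢0 , nonsquare) =
      [ (λ Dʰ≈1 → ⊥-elim (ℕP.<⇒≱ (ℕP.n<1+n h) (too-many-roots Dʰ≈1))) , (λ Dʰ≈-1 → Dʰ≈-1) ]′
        (square≈1 (power-h² (λ D≈0 → D≢0 (toCongruence D≈0))))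
      where
      D-not-square : All (λ s → ¬ D ≈ s) squares
      D-not-square = AllP.applyUpTo⁺₁ _ h λ {i} _ D≈i² → nonsquare (+ suc i , toCongruence (≈-sym D≈i²))
      -- D and the h squares would be h + 1 distinct roots of xʰ - 1.
      too-many-roots : D ^ h ≈ + 1 → suc h ℕ.≤ h
      too-many-roots Dʰ≈1 = subst₂ ℕ._≤_ (cong suc (ListP.length-applyUpTo _ h))
                              (Eq.trans (cong suc (ListP.length-replicate (ℕ.pred h))) (Eq.sym h≡1+[h-1]))
                              (root-bound xʰ-1 (D ∷ squares) (D-not-square ∷ squares-distinct)
                                (root-of-xʰ-1 Dʰ≈1 ∷ squares-are-roots))

module LucasSequences where

  open import Data.Nat as ℕ using (ℕ; zero; suc)
  open import Data.Integer as ℤ using (ℤ; +_; _+_; _*_; _-_; -_; _^_)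
  import Data.Integer.Properties as ℤP
  open import Data.Integer.Tactic.RingSolver using (solve-∀)
  open import Data.Product using (_,_; _×_; proj₁)
  open import Relation.Binary.PropositionalEquality as Eq using (_≡_; refl; cong; cong₂)

  module LucasIdentities (P Q : ℤ) where

    F : ℕ → ℤ
    F = lucas P Q

    Recurrent : (ℕ → ℤ) → Set
    Recurrent G = ∀ n → G (suc (suc n)) ≡ P * G (suc n) - Q * G n

    solution-formula : ∀ G → Recurrent G → ∀ k → G (suc k) ≡ G 1 * F (suc k) - Q * G 0 * F k
    solution-formula G rec k = proj₁ (both k)
      where
      step : ∀ g₀ g₁ a b c d → c ≡ g₁ * (P * b - Q * a) - Q * g₀ * b → d ≡ g₁ * b - Q * g₀ * a →
             P * c - Q * d ≡ g₁ * (P * (P * b - Q * a) - Q * b) - Q * g₀ * (P * b - Q * a)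
      step g₀ g₁ a b _ _ refl refl = lemma P Q g₀ g₁ a b
        where lemma : ∀ P Q g₀ g₁ a b → P * (g₁ * (P * b - Q * a) - Q * g₀ * b) - Q * (g₁ * b - Q * g₀ * a)
                                         ≡ g₁ * (P * (P * b - Q * a) - Q * b) - Q * g₀ * (P * b - Q * a)
              lemma = solve-∀
      both : ∀ k → (G (suc k) ≡ G 1 * F (suc k) - Q * G 0 * F k)
                 × (G (suc (suc k)) ≡ G 1 * F (suc (suc k)) - Q * G 0 * F (suc k))
      both zero    = base₁ Q (G 0) (G 1) , Eq.trans (rec 0) (base₂ P Q (G 0) (G 1))
        where base₁ : ∀ Q g₀ g₁ → g₁ ≡ g₁ * + 1 - Q * g₀ * + 0
              base₁ = solve-∀
              base₂ : ∀ P Q g₀ g₁ → P * g₁ - Q * g₀ ≡ g₁ * (P * + 1 - Q * + 0) - Q * g₀ * + 1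
              base₂ = solve-∀
      both (suc k) with both k
      ... | now , next = next , Eq.trans (rec (suc k)) (step (G 0) (G 1) (F k) (F (suc k)) _ _ next now)

    addition : ∀ k j → F (suc j ℕ.+ k) ≡ F (suc k) * F (suc j) - Q * F k * F j
    addition k j = solution-formula (λ n → F (n ℕ.+ k)) (λ n → refl) j

    cassini : ∀ j → F (suc j) * F (suc j) - F j * F (suc (suc j)) ≡ Q ^ j
    cassini zero    = lemma P Q
      where lemma : ∀ P Q → + 1 * + 1 - + 0 * (P * + 1 - Q * + 0) ≡ + 1
            lemma = solve-∀
    cassini (suc j) = Eq.trans (lemma P Q (F j) (F (suc j))) (cong (Q *_) (cassini j))
      where lemma : ∀ P Q a b → (P * b - Q * a) * (P * b - Q * a) - b * (P * (P * b - Q * a) - Q * b)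
                                ≡ Q * (b * b - a * (P * b - Q * a))
            lemma = solve-∀

    -- Reflection F(j+1) F(k+j) - F(j) F(k+j+1) = Qʲ F(k): the left side is a
    -- solution in k with initial values 0 and Qʲ (by Cassini).
    reflection : ∀ j k → F (suc j) * F (k ℕ.+ j) - F j * F (suc (k ℕ.+ j)) ≡ Q ^ j * F k
    reflection j zero    = Eq.trans (antisymmetric (F (suc j)) (F j)) (Eq.sym (ℤP.*-zeroʳ (Q ^ j)))
      where antisymmetric : ∀ a b → a * b - b * a ≡ + 0
            antisymmetric = solve-∀
    reflection j (suc k) = begin
      H (suc k)                                ≡⟨ solution-formula H recurrent k ⟩
      H 1 * F (suc k) - Q * H 0 * F k          ≡⟨ cong₂ (λ u v → u * F (suc k) - Q * v * F k) (cassini j) (antisymmetric (F (suc j)) (F j)) ⟩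
      Q ^ j * F (suc k) - Q * + 0 * F k        ≡⟨ drop-zero (Q ^ j * F (suc k)) Q (F k) ⟩
      Q ^ j * F (suc k)                        ∎
      where
      open Eq.≡-Reasoning
      H : ℕ → ℤ
      H k = F (suc j) * F (k ℕ.+ j) - F j * F (suc (k ℕ.+ j))
      antisymmetric : ∀ a b → a * b - b * a ≡ + 0
      antisymmetric = solve-∀
      drop-zero : ∀ u Q f → u - Q * + 0 * f ≡ u
      drop-zero = solve-∀
      recurrent : Recurrent H
      recurrent n = lemma P Q (F (suc j)) (F j) (F (n ℕ.+ j)) (F (suc (n ℕ.+ j)))
        where lemma : ∀ P Q c d x y → c * (P * y - Q * x) - d * (P * (P * y - Q * x) - Q * y)
                                      ≡ P * (c * y - d * (P * y - Q * x)) - Q * (c * x - d * y)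
              lemma = solve-∀

module NaturalNumbers where

  open import Data.Nat as ℕ using (ℕ; zero; suc; z≤n; s≤s; _+_; _*_; _∸_; _<_; _≤_; _/_)
  import Data.Nat.DivMod as ℕDM
  import Data.Nat.Divisibility as ℕD
  open import Data.Nat.Solver using (module +-*-Solver)
  open import Data.Sum using (_⊎_; inj₁; inj₂)
  import Data.Nat.Properties as ℕP
  open import Data.Product using (∃; _,_; _×_)
  open import Data.Empty using (⊥; ⊥-elim)
  open import Relation.Nullary using (yes; no)
  open import Algebra.Properties.CommutativeSemigroup ℕP.+-commutativeSemigroup using (interchange; x∙yz≈y∙xz)
  open import Relation.Binary.PropositionalEquality as Eq using (_≡_; _≢_; refl; cong; cong₂; sym; trans; subst)

  ∑ : ℕ → (ℕ → ℕ) → ℕ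
  ∑ zero    f = 0
  ∑ (suc n) f = f n + ∑ n f

  syntax ∑ n (λ i → e) = ∑[ i < n ] e

  ∑-cong : ∀ n {f g} → (∀ i → i < n → f i ≡ g i) → ∑ n f ≡ ∑ n g
  ∑-cong zero    eq = refl
  ∑-cong (suc n) eq = cong₂ _+_ (eq n ℕP.≤-refl) (∑-cong n (λ i i<n → eq i (ℕP.m<n⇒m<1+n i<n)))

  ∑-const : ∀ n c → ∑[ i < n ] c ≡ n * c
  ∑-const zero    c = refl
  ∑-const (suc n) c = cong (c +_) (∑-const n c)

  ∑-+ : ∀ n f g → ∑[ i < n ] (f i + g i) ≡ ∑ n f + ∑ n g
  ∑-+ zero    f g = refl
  ∑-+ (suc n) f g = trans (cong (f n + g n +_) (∑-+ n f g)) (interchange (f n) (g n) (∑ n f) (∑ n g))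

  ∑-swap : ∀ a b (f : ℕ → ℕ → ℕ) → ∑[ i < a ] ∑[ j < b ] f i j ≡ ∑[ j < b ] ∑[ i < a ] f i j
  ∑-swap zero    b f = sym (trans (∑-cong b (λ _ _ → refl)) (trans (∑-const b 0) (ℕP.*-zeroʳ b)))
  ∑-swap (suc a) b f = trans (cong (∑[ j < b ] f a j +_) (∑-swap a b f)) (sym (∑-+ b (λ j → f a j) (λ j → ∑[ i < a ] f i j)))

  ∑-blocks : ∀ q k f → ∑ (q * k) f ≡ ∑[ b < q ] ∑[ j < k ] f (j + b * k)
  ∑-blocks zero    k f = refl
  ∑-blocks (suc q) k f = trans (split k (q * k)) (cong (∑[ j < k ] f (j + q * k) +_) (∑-blocks q k f))
    where
    split : ∀ k n → ∑ (k + n) f ≡ ∑[ j < k ] f (j + n) + ∑ n f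
    split zero    n = refl
    split (suc k) n = trans (cong (f (k + n) +_) (split k n)) (sym (ℕP.+-assoc (f (k + n)) _ _))

  ∑-reverse : ∀ n f → ∑[ j < n ] f (n ∸ suc j) ≡ ∑ n f
  ∑-reverse zero    f = refl
  ∑-reverse (suc n) f = begin
    f (n ∸ n) + ∑[ j < n ] f (suc n ∸ suc j)   ≡⟨ cong₂ _+_ (cong f (ℕP.n∸n≡0 n)) (∑-cong n (λ j j<n → cong f (ℕP.+-∸-assoc 1 j<n))) ⟩
    f 0 + ∑[ j < n ] f (suc (n ∸ suc j))       ≡⟨ cong (f 0 +_) (∑-reverse n (λ i → f (suc i))) ⟩
    f 0 + ∑[ i < n ] f (suc i)                 ≡⟨ shift n ⟨
    ∑ (suc n) f                                ∎
    where
    open Eq.≡-Reasoning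
    shift : ∀ n → ∑ (suc n) f ≡ f 0 + ∑[ i < n ] f (suc i)
    shift zero    = refl
    shift (suc n) = trans (cong (f (suc n) +_) (shift n)) (x∙yz≈y∙xz (f (suc n)) (f 0) _)

  ∑-paired : ∀ n f → (∀ j → j < n → f j + f (n ∸ suc j) ≡ 1) → ∑ n f + ∑ n f ≡ n
  ∑-paired n f pairs = begin
    ∑ n f + ∑ n f                          ≡⟨ cong (∑ n f +_) (∑-reverse n f) ⟨
    ∑ n f + ∑[ j < n ] f (n ∸ suc j)       ≡⟨ ∑-+ n f (λ j → f (n ∸ suc j)) ⟨
    ∑[ j < n ] (f j + f (n ∸ suc j))       ≡⟨ ∑-cong n pairs ⟩
    ∑[ j < n ] 1                           ≡⟨ ∑-const n 1 ⟩
    n * 1                                  ≡⟨ ℕP.*-identityʳ n ⟩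
    n                                      ∎
    where open Eq.≡-Reasoning

  ∑-single : ∀ n {f} v → v < n → (∀ i → i < n → i ≢ v → f i ≡ 0) → f v ≡ 1 → ∑ n f ≡ 1
  ∑-single zero    v () _ _
  ∑-single (suc n) v v<1+n others fv≡1 with v ℕP.≟ n
  ... | yes refl = cong₂ _+_ fv≡1 (trans (∑-cong n (λ i i<n → others i (ℕP.m<n⇒m<1+n i<n) (ℕP.<⇒≢ i<n))) (trans (∑-const n 0) (ℕP.*-zeroʳ n)))
  ... | no v≢n   = cong₂ _+_ (others n ℕP.≤-refl (λ n≡v → v≢n (sym n≡v)))
                             (∑-single n v (ℕP.≤∧≢⇒< (ℕP.≤-pred v<1+n) v≢n) (λ i i<n → others i (ℕP.m<n⇒m<1+n i<n)) fv≡1)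

  ∑-positive : ∀ n f → 0 < ∑ n f → ∃ λ i → i < n × 0 < f i
  ∑-positive zero    f ()
  ∑-positive (suc n) f pos with f n in eq
  ... | suc _ = n , ℕP.≤-refl , subst (0 <_) (sym eq) ℕ.z<s
  ... | zero with ∑-positive n f pos
  ...   | i , i<n , fi>0 = i , ℕP.m<n⇒m<1+n i<n , fi>0

  ∑-at-most-one : ∀ n f → (∀ i → f i ≤ 1) → (∀ a b → a < b → b < n → f a ≡ 1 → f b ≡ 1 → ⊥) → ∑ n f ≤ 1
  ∑-at-most-one zero    f bound unique = z≤n
  ∑-at-most-one (suc n) f bound unique with f n in eq | bound n
  ... | zero      | _ = ∑-at-most-one n f bound (λ a b a<b b<n → unique a b a<b (ℕP.m<n⇒m<1+n b<n))
  ... | suc (suc _) | s≤s ()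
  ... | suc zero  | _ = ℕP.≤-reflexive (cong suc (trans (∑-cong n others) (trans (∑-const n 0) (ℕP.*-zeroʳ n))))
    where
    others : ∀ i → i < n → f i ≡ 0
    others i i<n with f i in eq′ | bound i
    ... | zero     | _ = refl
    ... | suc zero | _ = ⊥-elim (unique i n i<n ℕP.≤-refl eq′ eq)
    ... | suc (suc _) | s≤s ()

  ∑-all-one : ∀ n f → (∀ i → f i ≤ 1) → ∑ n f ≡ n → ∀ i → i < n → f i ≡ 1
  ∑-all-one zero    f bound total i ()
  ∑-all-one (suc n) f bound total i i<1+n with f n in eq | bound n
  ... | suc (suc _) | s≤s ()
  ... | zero     | _ = ⊥-elim (ℕP.<-irrefl total (s≤s (∑-bounded n)))
    where
    ∑-bounded : ∀ k → ∑ k f ≤ k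
    ∑-bounded zero    = z≤n
    ∑-bounded (suc k) = ℕP.+-mono-≤ (bound k) (∑-bounded k)
  ... | suc zero | _ with i ℕP.≟ n
  ...   | yes refl = eq
  ...   | no i≢n   = ∑-all-one n f bound (ℕP.suc-injective total) i (ℕP.≤∧≢⇒< (ℕP.≤-pred i<1+n) i≢n)

  Even Odd : ℕ → Set
  Even n = ∃ λ k → n ≡ k * 2
  Odd  n = ∃ λ k → n ≡ suc (k * 2)

  parity : ∀ n → Even n ⊎ Odd n
  parity zero    = inj₁ (0 , refl)
  parity (suc n) with parity n
  ... | inj₁ (k , n≡2k)   = inj₂ (k , cong suc n≡2k)
  ... | inj₂ (k , n≡2k+1) = inj₁ (suc k , cong suc n≡2k+1)

  even∧odd⇒⊥ : ∀ {n} → Even n → Odd n → ⊥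
  even∧odd⇒⊥ (a , refl) (b , eq) = helper a b eq
    where
    helper : ∀ a b → a * 2 ≡ suc (b * 2) → ⊥
    helper zero          b       ()
    helper (suc zero)    zero    ()
    helper (suc (suc a)) zero    ()
    helper (suc (suc a)) (suc b) eq = helper (suc a) b (ℕP.suc-injective (ℕP.suc-injective eq))

  odd*odd : ∀ {m n} → Odd m → Odd n → Odd (m * n)
  odd*odd {n = n} (a , refl) (b , refl) = a * (b * 2) + a + b , solve 2 (λ a b →
    (con 1 :+ a :* con 2) :* (con 1 :+ b :* con 2) := con 1 :+ (a :* (b :* con 2) :+ a :+ b) :* con 2) refl a b
    where open +-*-Solver using (solve; _:+_; _:*_; _:=_; con)

  even*any : ∀ {m} n → Even m → Even (m * n)
  even*any n (a , refl) = a * n , solve 2 (λ a n → a :* con 2 :* n := a :* n :* con 2) refl a n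
    where open +-*-Solver using (solve; _:+_; _:*_; _:=_; con)

  halve-product : ∀ t k n → t * (k * 2) ≡ n * 2 → t * k ≡ n
  halve-product t k n eq = ℕP.*-cancelʳ-≡ (t * k) n 2 (trans (ℕP.*-assoc t k 2) eq)

  swap-doubled : ∀ a b → a * 2 * b ≡ b * 2 * a
  swap-doubled a b = solve 2 (λ a b → a :* con 2 :* b := b :* con 2 :* a) refl a b
    where open +-*-Solver using (solve; _:*_; _:=_; con)

  double≡+ : ∀ k → k * 2 ≡ k + k
  double≡+ k = trans (ℕP.*-comm k 2) (cong (k +_) (ℕP.+-identityʳ k))

  half : ∀ {n k} → n ≡ k * 2 → n / 2 ≡ k
  half {k = k} refl = ℕDM.m*n/n≡m k 2

  divisor-of-double : ∀ {d h} → 0 < h → d ℕD.∣ h + h → h ≤ d → d ≡ h + h ⊎ d ≡ h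
  divisor-of-double {d} {h} h>0 (ℕD.divides c 2h≡cd) h≤d with c
  ... | 0 = ⊥-elim (ℕP.<⇒≢ (ℕP.+-mono-< h>0 h>0) (sym 2h≡cd))
  ... | 1 = inj₁ (sym (trans 2h≡cd (ℕP.+-identityʳ d)))
  ... | 2 = inj₂ (ℕP.*-cancelˡ-≡ d h 2 (trans (sym 2h≡cd) (cong (h +_) (sym (ℕP.+-identityʳ h)))))
  ... | suc (suc (suc c′)) = ⊥-elim (ℕP.<-irrefl 2h≡cd (ℕP.<-≤-trans (ℕP.m<n+m (h + h) d>0)
                                    (ℕP.+-monoʳ-≤ d (ℕP.+-mono-≤ h≤d (ℕP.≤-trans h≤d (ℕP.m≤m+n d (c′ * d)))))))
    where d>0 : 0 < d
          d>0 = ℕP.<-≤-trans h>0 h≤d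

  exclusive-sum≤1 : ∀ {a b} → a ≤ 1 → b ≤ 1 → (0 < a → 0 < b → ⊥) → a + b ≤ 1
  exclusive-sum≤1 {zero}        {b}     _        b≤1 _    = b≤1
  exclusive-sum≤1 {suc zero}    {zero}  _        _   _    = ℕP.≤-refl
  exclusive-sum≤1 {suc zero}    {suc b} _        _   both = ⊥-elim (both ℕ.z<s ℕ.z<s)
  exclusive-sum≤1 {suc (suc a)} {b}     (s≤s ()) _   _

module QuadraticExtensions where

  open ModularArithmetic
  open PrimeModuli
  open BinomialsAndFrobenius
  open FermatAndEuler
  open LucasSequences
  open import Data.Nat as ℕ using (ℕ; zero; suc)
  import Data.Nat.Properties as ℕP
  open import Data.Nat.Primality using (Prime)
  open import Data.Integer as ℤ using (ℤ; +_; _+_; _*_; _-_; -_; _^_)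
  import Data.Integer.Properties as ℤP
  open import Data.Integer.Tactic.RingSolver using (solve-∀)
  open import Data.Product using (_,_; _×_; proj₁; proj₂)
  open import Data.Product.Relation.Binary.Pointwise.NonDependent using (Pointwise; ×-isEquivalence)
  open import Data.Sum using ([_,_]′)
  open import Data.Empty using (⊥-elim)
  open import Relation.Binary.PropositionalEquality as Eq using (_≡_; refl; cong; cong₂)
  open import Algebra.Bundles using (CommutativeSemiring)
  import Relation.Binary.Reasoning.Setoid
  open import Algebra.Structures using (IsCommutativeSemiring; IsSemigroup)
  open import Algebra.Structures.Biased using (isCommutativeSemiringˡ; isCommutativeMonoidˡ)

  -- The ring ℤ[√D]: a pair (a , b) stands for a + b√D.
  module QuadraticExtension (D : ℤ) where

    infixl 6 _⊕_
    infixl 7 _⊗_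
    _⊕_ _⊗_ : ℤ × ℤ → ℤ × ℤ → ℤ × ℤ
    (a , b) ⊕ (c , d) = (a + c , b + d)
    (a , b) ⊗ (c , d) = (a * c + D * (b * d) , a * d + b * c)

    𝟘 𝟙 : ℤ × ℤ
    𝟘 = (+ 0 , + 0)
    𝟙 = (+ 1 , + 0)

    private
      semigroup : ∀ {_∙_ : ℤ × ℤ → ℤ × ℤ → ℤ × ℤ} → (∀ x y z → (x ∙ y) ∙ z ≡ x ∙ (y ∙ z)) → IsSemigroup _≡_ _∙_
      semigroup {_∙_} assoc = record
        { isMagma = record { isEquivalence = Eq.isEquivalence ; ∙-cong = cong₂ _∙_ } ; assoc = assoc }

    ℤ[√D]-isCommutativeSemiring : IsCommutativeSemiring _≡_ _⊕_ _⊗_ 𝟘 𝟙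
    ℤ[√D]-isCommutativeSemiring = isCommutativeSemiringˡ record
      { +-isCommutativeMonoid = isCommutativeMonoidˡ record
        { isSemigroup = semigroup λ { (a , b) (c , d) (e , f) → cong₂ _,_ (ℤP.+-assoc a c e) (ℤP.+-assoc b d f) }
        ; identityˡ = λ { (a , b) → cong₂ _,_ (ℤP.+-identityˡ a) (ℤP.+-identityˡ b) }
        ; comm = λ { (a , b) (c , d) → cong₂ _,_ (ℤP.+-comm a c) (ℤP.+-comm b d) } }
      ; *-isCommutativeMonoid = isCommutativeMonoidˡ record
        { isSemigroup = semigroup λ { (a , b) (c , d) (e , f) → cong₂ _,_ (assoc₁ D a b c d e f) (assoc₂ D a b c d e f) }
        ; identityˡ = λ { (a , b) → cong₂ _,_ (identity₁ D a b) (identity₂ a b) }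
        ; comm = λ { (a , b) (c , d) → cong₂ _,_ (comm₁ D a b c d) (comm₂ a b c d) } }
      ; distribʳ = λ { (a , b) (c , d) (e , f) → cong₂ _,_ (distrib₁ D a b c d e f) (distrib₂ a b c d e f) }
      ; zeroˡ = λ { (a , b) → cong₂ _,_ (zero₁ D a b) (zero₂ a b) } }
      where
      assoc₁ : ∀ D a b c d e f → (a * c + D * (b * d)) * e + D * ((a * d + b * c) * f) ≡ a * (c * e + D * (d * f)) + D * (b * (c * f + d * e))
      assoc₁ = solve-∀
      assoc₂ : ∀ D a b c d e f → (a * c + D * (b * d)) * f + (a * d + b * c) * e ≡ a * (c * f + d * e) + b * (c * e + D * (d * f))
      assoc₂ = solve-∀
      identity₁ : ∀ D a b → + 1 * a + D * (+ 0 * b) ≡ a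
      identity₁ = solve-∀
      identity₂ : ∀ a b → + 1 * b + + 0 * a ≡ b
      identity₂ = solve-∀
      comm₁ : ∀ D a b c d → a * c + D * (b * d) ≡ c * a + D * (d * b)
      comm₁ = solve-∀
      comm₂ : ∀ a b c d → a * d + b * c ≡ c * b + d * a
      comm₂ = solve-∀
      distrib₁ : ∀ D a b c d e f → (c + e) * a + D * ((d + f) * b) ≡ (c * a + D * (d * b)) + (e * a + D * (f * b))
      distrib₁ = solve-∀
      distrib₂ : ∀ a b c d e f → (c + e) * b + (d + f) * a ≡ (c * b + d * a) + (e * b + f * a)
      distrib₂ = solve-∀
      zero₁ : ∀ D a b → + 0 * a + D * (+ 0 * b) ≡ + 0
      zero₁ = solve-∀
      zero₂ : ∀ a b → + 0 * b + + 0 * a ≡ + 0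
      zero₂ = solve-∀

    module Modulo (p : ℕ) where
      open Congruence p

      infix 4 _≈₂_
      _≈₂_ : ℤ × ℤ → ℤ × ℤ → Set
      _≈₂_ = Pointwise _≈_ _≈_

      ⊕-cong : ∀ {x y u v} → x ≈₂ y → u ≈₂ v → x ⊕ u ≈₂ y ⊕ v
      ⊕-cong (a≈c , b≈d) (e≈g , f≈h) = +-cong a≈c e≈g , +-cong b≈d f≈h

      ⊗-cong : ∀ {x y u v} → x ≈₂ y → u ≈₂ v → x ⊗ u ≈₂ y ⊗ v
      ⊗-cong (a≈c , b≈d) (e≈g , f≈h) =
        +-cong (*-cong a≈c e≈g) (*-congˡ D (*-cong b≈d f≈h)) , +-cong (*-cong a≈c f≈h) (*-cong b≈d e≈g)

      ℤ[√D]mod : CommutativeSemiring _ _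
      ℤ[√D]mod = record { isCommutativeSemiring =
        coarsenCommutativeSemiring ℤ[√D]-isCommutativeSemiring ⊕-cong ⊗-cong }
        where open Coarsening (×-isEquivalence ≈-isEquivalence ≈-isEquivalence)

      module ≈₂-Reasoning = Relation.Binary.Reasoning.Setoid (CommutativeSemiring.setoid ℤ[√D]mod)

  -- In ℤ[√D]/p the Frobenius map gives
  -- (P + √D)^p ≡ P^p + D^h √D ≡ P - √D, and (P + √D)^n = aₙ + bₙ√D with
  -- 2bₙ = 2ⁿ F(n).
  module LucasAtPrime (p : ℕ) (p-prime : Prime p) (h : ℕ) (p≡2h+1 : p ≡ suc (h ℕ.+ h))
                      (P Q : ℤ) (D-nonresidue : IsQuadNonResidue (P * P - + 4 * Q) p) where

    open PrimeModulus p p-prime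
    open Fermat p p-prime using (fermat-^p)
    open EulerCriterion p p-prime h p≡2h+1 using (nonresidue-power; 2<p)
    open OddModulus 2<p using (2≉0)
    open LucasIdentities P Q using (F)

    D : ℤ
    D = P * P - + 4 * Q

    open QuadraticExtension D
    open Modulo p
    open Frobenius ℤ[√D]mod using (HasCharacteristic; frobenius)
    open import Algebra.Definitions.RawSemiring (CommutativeSemiring.rawSemiring ℤ[√D]mod) using () renaming (_^_ to _^₂_)
    open import Algebra.Definitions.RawMonoid (CommutativeSemiring.+-rawMonoid ℤ[√D]mod) using () renaming (_×_ to _×₂_)

    ×₂-components : ∀ n a b → n ×₂ (a , b) ≡ (+ n * a , + n * b)
    ×₂-components zero    a b = cong₂ _,_ (Eq.sym (ℤP.*-zeroˡ a)) (Eq.sym (ℤP.*-zeroˡ b))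
    ×₂-components (suc n) a b = Eq.trans (cong ((a , b) ⊕_) (×₂-components n a b)) (cong₂ _,_ (lemma (+ n) a) (lemma (+ n) b))
      where lemma : ∀ n a → a + n * a ≡ (+ 1 + n) * a
            lemma = solve-∀

    ℤ[√D]-characteristic : HasCharacteristic p
    ℤ[√D]-characteristic (a , b) rewrite ×₂-components p a b = vanish a , vanish b
      where vanish : ∀ a → + p * a ≈ + 0
            vanish a = ≈-trans (≡⇒≈ (ℤP.*-comm (+ p) a)) (multiple≈0 a)

    rational-power : ∀ a n → (a , + 0) ^₂ n ≡ (a ^ n , + 0)
    rational-power a zero    = refl
    rational-power a (suc n) rewrite rational-power a n = cong₂ _,_ (lemma₁ D a (a ^ n)) (lemma₂ a (a ^ n))
      where lemma₁ : ∀ D a b → a * b + D * (+ 0 * + 0) ≡ a * b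
            lemma₁ = solve-∀
            lemma₂ : ∀ a b → a * + 0 + + 0 * b ≡ + 0
            lemma₂ = solve-∀

    √D-power : ∀ k → (+ 0 , + 1) ^₂ suc (k ℕ.+ k) ≡ (+ 0 , D ^ k)
    √D-power zero    = cong₂ _,_ (lemma D) refl
      where lemma : ∀ D → + 0 * + 1 + D * (+ 1 * + 0) ≡ + 0
            lemma = solve-∀
    √D-power (suc k) = begin
      (+ 0 , + 1) ^₂ suc (suc k ℕ.+ suc k)                           ≡⟨ cong (λ n → (+ 0 , + 1) ^₂ suc (suc n)) (ℕP.+-suc k k) ⟩
      (+ 0 , + 1) ⊗ ((+ 0 , + 1) ⊗ ((+ 0 , + 1) ^₂ suc (k ℕ.+ k)))   ≡⟨ cong (λ x → (+ 0 , + 1) ⊗ ((+ 0 , + 1) ⊗ x)) (√D-power k) ⟩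
      (+ 0 , + 1) ⊗ ((+ 0 , + 1) ⊗ (+ 0 , D ^ k))                    ≡⟨ cong₂ _,_ (lemma₁ D (D ^ k)) (lemma₂ D (D ^ k)) ⟩
      (+ 0 , D ^ suc k)                                              ∎
      where
      open Eq.≡-Reasoning
      lemma₁ : ∀ D e → + 0 * (+ 0 * + 0 + D * (+ 1 * e)) + D * (+ 1 * (+ 0 * e + + 1 * + 0)) ≡ + 0
      lemma₁ = solve-∀
      lemma₂ : ∀ D e → + 0 * (+ 0 * e + + 1 * + 0) + + 1 * (+ 0 * + 0 + D * (+ 1 * e)) ≡ D * e
      lemma₂ = solve-∀

    α : ℕ → ℤ × ℤ
    α n = (P , + 1) ^₂ n

    α-components : ∀ n → (+ 2 * proj₂ (α n) ≡ (+ 2) ^ n * F n)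
                       × (+ 2 * proj₁ (α n) ≡ (+ 2) ^ n * (+ 2 * F (suc n) - P * F n))
    α-components zero    = refl , lemma P
      where lemma : ∀ P → + 2 * + 1 ≡ + 1 * (+ 2 * + 1 - P * + 0)
            lemma = solve-∀
    α-components (suc n) with α n | α-components n
    ... | (a , b) | (b-eq , a-eq) =
        Eq.trans (lemma₁ P a b) (Eq.trans (cong₂ (λ u v → P * u + v) b-eq a-eq) (lemma₂ P ((+ 2) ^ n) (F n) (F (suc n))))
      , Eq.trans (lemma₃ P D a b) (Eq.trans (cong₂ (λ u v → P * u + D * v) a-eq b-eq) (lemma₄ P Q ((+ 2) ^ n) (F n) (F (suc n))))
      where
      lemma₁ : ∀ P a b → + 2 * (P * b + + 1 * a) ≡ P * (+ 2 * b) + + 2 * a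
      lemma₁ = solve-∀
      lemma₂ : ∀ P t f f′ → P * (t * f) + t * (+ 2 * f′ - P * f) ≡ + 2 * t * f′
      lemma₂ = solve-∀
      lemma₃ : ∀ P D a b → + 2 * (P * a + D * (+ 1 * b)) ≡ P * (+ 2 * a) + D * (+ 2 * b)
      lemma₃ = solve-∀
      lemma₄ : ∀ P Q t f f′ → P * (t * (+ 2 * f′ - P * f)) + (P * P - + 4 * Q) * (t * f) ≡ + 2 * t * (+ 2 * (P * f′ - Q * f) - P * f′)
      lemma₄ = solve-∀

    α-at-p : α p ≈₂ (P , - + 1)
    α-at-p = begin
      (P , + 1) ^₂ p                       ≡⟨ cong (_^₂ p) (cong₂ _,_ (Eq.sym (ℤP.+-identityʳ P)) refl) ⟩
      ((P , + 0) ⊕ (+ 0 , + 1)) ^₂ p       ≈⟨ frobenius p-prime ℤ[√D]-characteristic (P , + 0) (+ 0 , + 1) ⟩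
      (P , + 0) ^₂ p ⊕ (+ 0 , + 1) ^₂ p    ≡⟨ cong₂ _⊕_ (rational-power P p) √Dᵖ ⟩
      (P ^ p , + 0) ⊕ (+ 0 , D ^ h)        ≈⟨ ≈-trans (≡⇒≈ (ℤP.+-identityʳ (P ^ p))) (fermat-^p P)
                                            , ≈-trans (≡⇒≈ (ℤP.+-identityˡ (D ^ h))) (nonresidue-power D-nonresidue) ⟩
      (P , - + 1)                          ∎
      where
      open ≈₂-Reasoning
      √Dᵖ : (+ 0 , + 1) ^₂ p ≡ (+ 0 , D ^ h)
      √Dᵖ = Eq.trans (cong ((+ 0 , + 1) ^₂_) p≡2h+1) (√D-power h)

    F-at-p : F p ≈ - + 1
    F-at-p = cancelˡ 2≉0 (begin
      + 2 * F p           ≈⟨ *-congʳ (F p) (fermat-^p (+ 2)) ⟨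
      (+ 2) ^ p * F p     ≡⟨ proj₁ (α-components p) ⟨
      + 2 * proj₂ (α p)   ≈⟨ *-congˡ (+ 2) (proj₂ α-at-p) ⟩
      + 2 * - + 1         ∎)
      where open ≈-Reasoning

    -- (P + √D)^(p+1) ≡ (P + √D)(P - √D) has no √D-part.
    F-at-p+1 : F (suc p) ≈ + 0
    F-at-p+1 = [ (λ 2ᵖ⁺¹≈0 → ⊥-elim (nonzero-^ (suc p) 2≉0 2ᵖ⁺¹≈0)) , (λ F≈0 → F≈0) ]′ (zero-product (begin
      (+ 2) ^ suc p * F (suc p)                     ≡⟨ proj₁ (α-components (suc p)) ⟨
      + 2 * (P * proj₂ (α p) + + 1 * proj₁ (α p))   ≈⟨ *-congˡ (+ 2) (+-cong (*-congˡ P (proj₂ α-at-p)) (*-congˡ (+ 1) (proj₁ α-at-p))) ⟩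
      + 2 * (P * - + 1 + + 1 * P)                   ≡⟨ lemma P ⟩
      + 0                                           ∎))
      where open ≈-Reasoning
            lemma : ∀ P → + 2 * (P * - + 1 + + 1 * P) ≡ + 0
            lemma = solve-∀

    F-at-p+2 : F (suc (suc p)) ≈ Q
    F-at-p+2 = begin
      P * F (suc p) - Q * F p ≈⟨ -‿cong (*-congˡ P F-at-p+1) (*-congˡ Q F-at-p) ⟩
      P * + 0 - Q * - + 1     ≡⟨ lemma P Q ⟩
      Q                       ∎
      where open ≈-Reasoning
            lemma : ∀ P Q → P * + 0 - Q * - + 1 ≡ Q
            lemma = solve-∀

module OrdersAndRanks where

  open ModularArithmetic
  open PrimeModuli
  open LucasSequences
  open import Data.Nat as ℕ using (ℕ; zero; suc)
  import Data.Nat.Properties as ℕP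
  import Data.Nat.Divisibility as ℕD
  import Data.Nat.DivMod as ℕDM
  open import Data.Nat.Primality using (Prime)
  open import Data.Integer as ℤ using (ℤ; +_; _+_; _*_; _-_; -_; _^_)
  import Data.Integer.Properties as ℤP
  open import Data.Integer.Tactic.RingSolver using (solve-∀)
  open import Data.Product using (_,_; proj₁; proj₂)
  open import Data.Empty using (⊥-elim)
  open import Relation.Nullary using (¬_)
  open import Algebra.Properties.CommutativeSemigroup ℕP.+-commutativeSemigroup using (x∙yz≈xz∙y)
  open import Relation.Binary.PropositionalEquality as Eq using (_≡_; refl; cong; subst)

  least-index-divides : ∀ {m} (Holds : ℕ → Set) → 0 ℕ.< m →
    (∀ r → 0 ℕ.< r → r ℕ.< m → ¬ Holds r) → (∀ q r → Holds (r ℕ.+ q ℕ.* m) → Holds r) →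
    ∀ n → Holds n → m ℕD.∣ n
  least-index-divides {m} Holds m>0 least reduce n holds-n = ℕD.m%n≡0⇒n∣m n m (remainder≡0 (n ℕ.% m) refl)
    where
    instance _ = ℕ.>-nonZero m>0
    holds-remainder : Holds (n ℕ.% m)
    holds-remainder = reduce (n ℕ./ m) (n ℕ.% m) (subst Holds (ℕDM.m≡m%n+[m/n]*n n m) holds-n)
    remainder≡0 : ∀ r → n ℕ.% m ≡ r → n ℕ.% m ≡ 0
    remainder≡0 zero    eq = eq
    remainder≡0 (suc r) eq = ⊥-elim (least (suc r) ℕ.z<s (subst (ℕ._< m) eq (ℕDM.m%n<n n m)) (subst Holds eq holds-remainder))

  module MultiplicativeOrder (p : ℕ) (p-prime : Prime p) where

    open PrimeModulus p p-prime
    open ≈-Reasoning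

    power-of-one : ∀ {x} n → x ≈ + 1 → x ^ n ≈ + 1
    power-of-one {x} n x≈1 = ≈-trans (^-cong n x≈1) (≡⇒≈ (ℤP.^-zeroˡ n))

    order-nonzero : ∀ {a m} → IsMultOrder a p m → ¬ a ≈ + 0
    order-nonzero {a} {suc m} (_ , aᵐ⁺¹≡1 , _) a≈0 = 1≉0 (begin
      + 1           ≈⟨ fromCongruence aᵐ⁺¹≡1 ⟨
      a * a ^ m     ≈⟨ *-congʳ (a ^ m) a≈0 ⟩
      + 0 * a ^ m   ≡⟨ ℤP.*-zeroˡ (a ^ m) ⟩
      + 0           ∎)

    order-divides : ∀ {a m} → IsMultOrder a p m → ∀ n → a ^ n ≈ + 1 → m ℕD.∣ n
    order-divides {a} {m} (m>0 , aᵐ≡1 , least) =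
      least-index-divides (λ n → a ^ n ≈ + 1) m>0 (λ r r>0 r<m aʳ≈1 → least r r>0 r<m (toCongruence aʳ≈1)) reduce
      where
      reduce : ∀ q r → a ^ (r ℕ.+ q ℕ.* m) ≈ + 1 → a ^ r ≈ + 1
      reduce q r a^n≈1 = begin
        a ^ r                     ≡⟨ ℤP.*-identityʳ (a ^ r) ⟨
        a ^ r * + 1               ≈⟨ *-congˡ (a ^ r) (power-of-one q (fromCongruence aᵐ≡1)) ⟨
        a ^ r * (a ^ m) ^ q       ≡⟨ cong (a ^ r *_) (ℤP.^-*-assoc a m q) ⟩
        a ^ r * a ^ (m ℕ.* q)     ≡⟨ ℤP.^-distribˡ-+-* a r (m ℕ.* q) ⟨
        a ^ (r ℕ.+ m ℕ.* q)       ≡⟨ cong (λ k → a ^ (r ℕ.+ k)) (ℕP.*-comm m q) ⟩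
        a ^ (r ℕ.+ q ℕ.* m)       ≈⟨ a^n≈1 ⟩
        + 1                       ∎

    powers-distinct : ∀ {a m c} → IsMultOrder a p m → ¬ c ≈ + 0 →
                      ∀ {i j} → i ℕ.< j → j ℕ.< m → ¬ a ^ i * c ≈ a ^ j * c
    powers-distinct {a} {m} {c} order@(_ , _ , least) c≉0 {i} {j} i<j j<m aⁱc≈aʲc =
      least (j ℕ.∸ i) (ℕP.m<n⇒0<n∸m i<j) (ℕP.≤-<-trans (ℕP.m∸n≤m j i) j<m) (toCongruence (≈-sym (cancelˡ aⁱc≉0 (begin
        a ^ i * c * + 1             ≡⟨ ℤP.*-identityʳ (a ^ i * c) ⟩
        a ^ i * c                   ≈⟨ aⁱc≈aʲc ⟩
        a ^ j * c                   ≡⟨ cong (λ k → a ^ k * c) (ℕP.m+[n∸m]≡n (ℕP.<⇒≤ i<j)) ⟨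
        a ^ (i ℕ.+ (j ℕ.∸ i)) * c   ≡⟨ regroup (a ^ i) (a ^ (j ℕ.∸ i)) c (ℤP.^-distribˡ-+-* a i (j ℕ.∸ i)) ⟩
        a ^ i * c * a ^ (j ℕ.∸ i)   ∎))))
      where
      aⁱc≉0 : ¬ a ^ i * c ≈ + 0
      aⁱc≉0 = nonzero-* (nonzero-^ i (order-nonzero order)) c≉0
      regroup : ∀ x y c {z} → z ≡ x * y → z * c ≡ x * c * y
      regroup x y c refl = rearrange x y c
        where rearrange : ∀ x y c → x * y * c ≡ x * c * y
              rearrange = solve-∀

  module RankOfApparition (p : ℕ) (p-prime : Prime p) (P Q : ℤ) (Q≉0 : ¬ Congruence._≈_ p Q (+ 0))
                          (ρ : ℕ) (ρ-rank : IsRankOfApparition P Q p ρ) where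

    open PrimeModulus p p-prime
    open LucasIdentities P Q
    open ≈-Reasoning

    ρ>0 : 0 ℕ.< ρ
    ρ>0 = proj₁ ρ-rank

    F[ρ]≈0 : F ρ ≈ + 0
    F[ρ]≈0 = fromCongruence (proj₁ (proj₂ ρ-rank))

    F-nonzero-below-ρ : ∀ k → 0 ℕ.< k → k ℕ.< ρ → ¬ F k ≈ + 0
    F-nonzero-below-ρ k k>0 k<ρ F[k]≈0 = proj₂ (proj₂ ρ-rank) k k>0 k<ρ (toCongruence F[k]≈0)

    μ : ℤ
    μ = F (suc ρ)

    shift-by-ρ : ∀ j → F (j ℕ.+ ρ) ≈ μ * F j
    shift-by-ρ zero    = ≈-trans F[ρ]≈0 (≡⇒≈ (Eq.sym (ℤP.*-zeroʳ μ)))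
    shift-by-ρ (suc j) = begin
      F (suc j ℕ.+ ρ)                     ≡⟨ addition ρ j ⟩
      μ * F (suc j) - Q * F ρ * F j       ≈⟨ -‿cong (≈-refl {μ * F (suc j)}) (*-congʳ (F j) (*-congˡ Q F[ρ]≈0)) ⟩
      μ * F (suc j) - Q * + 0 * F j       ≡⟨ lemma (μ * F (suc j)) Q (F j) ⟩
      μ * F (suc j)                       ∎
      where lemma : ∀ x Q y → x - Q * + 0 * y ≡ x
            lemma = solve-∀

    shift-by-blocks : ∀ q j → F (j ℕ.+ q ℕ.* ρ) ≈ μ ^ q * F j
    shift-by-blocks zero    j = ≡⇒≈ (Eq.trans (cong F (ℕP.+-identityʳ j)) (Eq.sym (ℤP.*-identityˡ (F j))))
    shift-by-blocks (suc q) j = begin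
      F (j ℕ.+ (ρ ℕ.+ q ℕ.* ρ))     ≡⟨ cong F (x∙yz≈xz∙y j ρ (q ℕ.* ρ)) ⟩
      F ((j ℕ.+ q ℕ.* ρ) ℕ.+ ρ)     ≈⟨ shift-by-ρ (j ℕ.+ q ℕ.* ρ) ⟩
      μ * F (j ℕ.+ q ℕ.* ρ)         ≈⟨ *-congˡ μ (shift-by-blocks q j) ⟩
      μ * (μ ^ q * F j)             ≡⟨ ℤP.*-assoc μ (μ ^ q) (F j) ⟨
      μ ^ suc q * F j               ∎

    reflection-at-ρ : ∀ j k → k ℕ.+ j ≡ ρ → Q ^ j * F k ≈ - (μ * F j)
    reflection-at-ρ j k k+j≡ρ = begin
      Q ^ j * F k                                             ≡⟨ reflection j k ⟨
      F (suc j) * F (k ℕ.+ j) - F j * F (suc (k ℕ.+ j))       ≡⟨ cong (λ n → F (suc j) * F n - F j * F (suc n)) k+j≡ρ ⟩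
      F (suc j) * F ρ - F j * μ                               ≈⟨ -‿cong (*-congˡ (F (suc j)) F[ρ]≈0) (≈-refl {F j * μ}) ⟩
      F (suc j) * + 0 - F j * μ                               ≡⟨ lemma (F (suc j)) (F j) μ ⟩
      - (μ * F j)                                             ∎
      where lemma : ∀ a b μ → a * + 0 - b * μ ≡ - (μ * b)
            lemma = solve-∀

    μ² : μ * μ ≈ Q ^ ρ
    μ² = begin
      μ * μ                                ≡⟨ lemma (μ * μ) (F (suc (suc ρ))) ⟨
      μ * μ - + 0 * F (suc (suc ρ))        ≈⟨ -‿cong (≈-refl {μ * μ}) (*-congʳ (F (suc (suc ρ))) F[ρ]≈0) ⟨
      μ * μ - F ρ * F (suc (suc ρ))        ≡⟨ cassini ρ ⟩
      Q ^ ρ                                ∎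
      where lemma : ∀ a x → a - + 0 * x ≡ a
            lemma = solve-∀

    μ≉0 : ¬ μ ≈ + 0
    μ≉0 μ≈0 = nonzero-^ ρ Q≉0 (begin
      Q ^ ρ    ≈⟨ μ² ⟨
      μ * μ    ≈⟨ *-congʳ μ μ≈0 ⟩
      + 0 * μ  ≡⟨ ℤP.*-zeroˡ μ ⟩
      + 0      ∎)

    zeros-at-multiples : ∀ n → F n ≈ + 0 → ρ ℕD.∣ n
    zeros-at-multiples = least-index-divides (λ n → F n ≈ + 0) ρ>0 F-nonzero-below-ρ reduce
      where
      reduce : ∀ q r → F (r ℕ.+ q ℕ.* ρ) ≈ + 0 → F r ≈ + 0
      reduce q r F≈0 = cancelˡ (nonzero-^ q μ≉0) (begin
        μ ^ q * F r              ≈⟨ shift-by-blocks q r ⟨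
        F (r ℕ.+ q ℕ.* ρ)        ≈⟨ F≈0 ⟩
        + 0                      ≡⟨ ℤP.*-zeroʳ (μ ^ q) ⟨
        μ ^ q * + 0              ∎)

module Periods where

  open ModularArithmetic
  open PrimeModuli
  open FermatAndEuler
  open LucasSequences
  open QuadraticExtensions
  open NaturalNumbers
  open OrdersAndRanks
  open import Data.Nat as ℕ using (ℕ; suc)
  import Data.Nat.Properties as ℕP
  import Data.Nat.Divisibility as ℕD
  open import Data.Nat.Primality using (Prime)
  open import Data.Integer as ℤ using (ℤ; +_; _+_; _*_; _-_; -_; _^_)
  import Data.Integer.Properties as ℤP
  open import Data.Integer.Tactic.RingSolver using (solve-∀)
  open import Data.Product using (_,_; proj₁; proj₂)
  open import Data.Sum using (_⊎_; [_,_]′)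
  open import Data.Empty using (⊥; ⊥-elim)
  open import Relation.Nullary using (¬_)
  open import Relation.Binary.PropositionalEquality as Eq using (_≡_; cong; subst)

  -- The Pisano period is π = s·ρ, where s is the multiplicative order of μ:
  -- by the block structure, k ↦ k + s′ρ is a period exactly when μ^s′ ≡ 1.
  module PisanoPeriod (p : ℕ) (p-prime : Prime p) (P Q : ℤ) (Q≉0 : ¬ Congruence._≈_ p Q (+ 0))
                      (ρ : ℕ) (ρ-rank : IsRankOfApparition P Q p ρ)
                      (π : ℕ) (π-period : IsPisanoPeriod P Q p π) where

    open PrimeModulus p p-prime
    open LucasIdentities P Q using (F)
    open RankOfApparition p p-prime P Q Q≉0 ρ ρ-rank
    open ≈-Reasoning

    period : ∀ k → F (π ℕ.+ k) ≈ F k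
    period k = fromCongruence (proj₁ (proj₂ π-period) k)

    ρ∣π : ρ ℕD.∣ π
    ρ∣π = zeros-at-multiples π (subst (λ n → F n ≈ + 0) (ℕP.+-identityʳ π) (period 0))

    s : ℕ
    s = ℕD._∣_.quotient ρ∣π

    π≡s*ρ : π ≡ s ℕ.* ρ
    π≡s*ρ = ℕD._∣_.equality ρ∣π

    shift-by-blocks′ : ∀ s′ k → F (s′ ℕ.* ρ ℕ.+ k) ≈ μ ^ s′ * F k
    shift-by-blocks′ s′ k = subst (λ n → F n ≈ μ ^ s′ * F k) (ℕP.+-comm k (s′ ℕ.* ρ)) (shift-by-blocks s′ k)

    μ-order : IsMultOrder μ p s
    μ-order = s>0 , toCongruence μˢ≈1 , minimal
      where
      s>0 : 0 ℕ.< s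
      s>0 = ℕP.n≢0⇒n>0 λ s≡0 → ℕP.<⇒≢ (proj₁ π-period) (Eq.sym (Eq.trans π≡s*ρ (cong (ℕ._* ρ) s≡0)))
      μˢ≈1 : μ ^ s ≈ + 1
      μˢ≈1 = begin
        μ ^ s                 ≡⟨ ℤP.*-identityʳ (μ ^ s) ⟨
        μ ^ s * F 1           ≈⟨ shift-by-blocks′ s 1 ⟨
        F (s ℕ.* ρ ℕ.+ 1)     ≡⟨ cong (λ n → F (n ℕ.+ 1)) π≡s*ρ ⟨
        F (π ℕ.+ 1)           ≈⟨ period 1 ⟩
        + 1                   ∎
      minimal : ∀ s′ → 0 ℕ.< s′ → s′ ℕ.< s → ¬ (μ ^ s′) ≡ + 1 [mod p ]
      minimal s′ s′>0 s′<s μˢ′≡1 = proj₂ (proj₂ π-period) (s′ ℕ.* ρ)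
        (ℕP.*-monoˡ-< ρ s′>0) (subst (s′ ℕ.* ρ ℕ.<_) (Eq.sym π≡s*ρ) (ℕP.*-monoˡ-< ρ s′<s))
        (λ k → toCongruence (begin
          F (s′ ℕ.* ρ ℕ.+ k)  ≈⟨ shift-by-blocks′ s′ k ⟩
          μ ^ s′ * F k        ≈⟨ *-congʳ (F k) (fromCongruence {μ ^ s′} {+ 1} μˢ′≡1) ⟩
          + 1 * F k           ≡⟨ ℤP.*-identityˡ (F k) ⟩
          F k                 ∎))
        where instance _ = ℕ.>-nonZero ρ>0

  -- At a prime p = 2h + 1 for which D = P² - 4Q is a nonresidue and Q has
  -- order o ≥ h: since F(p+1) ≡ 0 and F(p+2) ≡ Q, we have ρ ∣ p + 1 and
  -- μ^t ≡ Q for t = (p+1)/ρ.  Hence Q^s ≡ 1, so h ≤ o ≤ s ∣ p - 1 and s is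
  -- 2h or h; in the second case ρ and h are both odd.
  module PeriodAtPrime (p : ℕ) (p-prime : Prime p) (h : ℕ) (p≡2h+1 : p ≡ suc (h ℕ.+ h))
                       (P Q : ℤ) (D-nonresidue : IsQuadNonResidue (P * P - + 4 * Q) p)
                       (o : ℕ) (Q-order : IsMultOrder Q p o) (h≤o : h ℕ.≤ o)
                       (ρ : ℕ) (ρ-rank : IsRankOfApparition P Q p ρ)
                       (π : ℕ) (π-period : IsPisanoPeriod P Q p π) where

    open PrimeModulus p p-prime
    open OddModulus
    open MultiplicativeOrder p p-prime
    open Fermat p p-prime using (fermat)
    open EulerCriterion p p-prime h p≡2h+1 using (0<h; 2<p)
    open LucasIdentities P Q using (F)
    open LucasAtPrime p p-prime h p≡2h+1 P Q D-nonresidue using (F-at-p+1; F-at-p+2)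
    open ≈-Reasoning

    Q≉0 : ¬ Q ≈ + 0
    Q≉0 = order-nonzero Q-order

    open PisanoPeriod p p-prime P Q Q≉0 ρ ρ-rank π π-period public
    open RankOfApparition p p-prime P Q Q≉0 ρ ρ-rank public

    ρ∣p+1 : ρ ℕD.∣ suc p
    ρ∣p+1 = zeros-at-multiples (suc p) F-at-p+1

    t : ℕ
    t = ℕD._∣_.quotient ρ∣p+1

    p+1≡t*ρ : suc p ≡ t ℕ.* ρ
    p+1≡t*ρ = ℕD._∣_.equality ρ∣p+1

    p+1≡[h+1]*2 : suc p ≡ suc h ℕ.* 2
    p+1≡[h+1]*2 = Eq.trans (cong suc p≡2h+1) (cong (λ n → suc (suc n)) (Eq.sym (double≡+ h)))

    μᵗ≈Q : μ ^ t ≈ Q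
    μᵗ≈Q = begin
      μ ^ t                ≡⟨ ℤP.*-identityʳ (μ ^ t) ⟨
      μ ^ t * F 1          ≈⟨ shift-by-blocks′ t 1 ⟨
      F (t ℕ.* ρ ℕ.+ 1)    ≡⟨ cong (λ n → F (n ℕ.+ 1)) p+1≡t*ρ ⟨
      F (suc p ℕ.+ 1)      ≡⟨ cong F (ℕP.+-comm (suc p) 1) ⟩
      F (suc (suc p))      ≈⟨ F-at-p+2 ⟩
      Q                    ∎

    μˢ≈1 : μ ^ s ≈ + 1
    μˢ≈1 = fromCongruence (proj₁ (proj₂ μ-order))

    Qˢ≈1 : Q ^ s ≈ + 1
    Qˢ≈1 = begin
      Q ^ s          ≈⟨ ^-cong s μᵗ≈Q ⟨
      (μ ^ t) ^ s    ≡⟨ ^-*-comm μ t s ⟩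
      (μ ^ s) ^ t    ≈⟨ power-of-one t μˢ≈1 ⟩
      + 1            ∎

    s-cases : s ≡ h ℕ.+ h ⊎ s ≡ h
    s-cases = divisor-of-double 0<h s∣2h h≤s
      where
      s∣2h : s ℕD.∣ h ℕ.+ h
      s∣2h = subst (s ℕD.∣_) (cong ℕ.pred p≡2h+1) (order-divides μ-order (p ℕ.∸ 1) (fermat μ≉0))
      h≤s : h ℕ.≤ s
      h≤s = ℕP.≤-trans h≤o (ℕD.∣⇒≤ {{ℕ.>-nonZero (proj₁ μ-order)}} (order-divides Q-order s Qˢ≈1))

    half-rank : ∀ k → k ℕ.+ k ≡ ρ → Q ^ k ≈ - μ
    half-rank k k+k≡ρ = cancelˡ F[k]≉0 (begin
      F k * Q ^ k        ≡⟨ ℤP.*-comm (F k) (Q ^ k) ⟩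
      Q ^ k * F k        ≈⟨ reflection-at-ρ k k k+k≡ρ ⟩
      - (μ * F k)        ≡⟨ lemma μ (F k) ⟩
      F k * - μ          ∎)
      where
      lemma : ∀ μ f → - (μ * f) ≡ f * - μ
      lemma = solve-∀
      k>0 : 0 ℕ.< k
      k>0 = ℕP.n≢0⇒n>0 λ k≡0 → ℕP.<⇒≢ ρ>0 (Eq.trans (Eq.sym (cong (λ n → n ℕ.+ n) k≡0)) k+k≡ρ)
      F[k]≉0 : ¬ F k ≈ + 0
      F[k]≉0 = F-nonzero-below-ρ k k>0 (subst (k ℕ.<_) k+k≡ρ (ℕP.m<m+n k k>0))

    module HalfOrder (s≡h : s ≡ h) where

      μʰ≈1 : μ ^ h ≈ + 1
      μʰ≈1 = subst (λ n → μ ^ n ≈ + 1) s≡h μˢ≈1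

      Qʰ≈1 : Q ^ h ≈ + 1
      Qʰ≈1 = subst (λ n → Q ^ n ≈ + 1) s≡h Qˢ≈1

      -- An even rank ρ = 2k forces h to be even: (-1)ʰ ≡ (-μ)ʰ ≡ (Q^k)ʰ ≡ 1.
      h-even-if-ρ-even : ∀ k → ρ ≡ k ℕ.* 2 → Even h
      h-even-if-ρ-even k ρ≡2k = [ (λ even → even) , (λ { (j , h≡2j+1) → ⊥-elim (1≉-1 2<p (≈-trans (≈-sym [-1]ʰ≈1)
                                   (≡⇒≈ (Eq.trans (cong ((- + 1) ^_) h≡2j+1) (-1^odd j))))) }) ]′ (parity h)
        where
        [-1]ʰ≈1 : (- + 1) ^ h ≈ + 1
        [-1]ʰ≈1 = begin
          (- + 1) ^ h                ≡⟨ ℤP.*-identityʳ _ ⟨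
          (- + 1) ^ h * + 1          ≈⟨ *-congˡ ((- + 1) ^ h) μʰ≈1 ⟨
          (- + 1) ^ h * μ ^ h        ≡⟨ neg-power μ h ⟨
          (- μ) ^ h                  ≈⟨ ^-cong h (half-rank k (Eq.trans (Eq.sym (double≡+ k)) (Eq.sym ρ≡2k))) ⟨
          (Q ^ k) ^ h                ≡⟨ ^-*-comm Q k h ⟩
          (Q ^ h) ^ k                ≈⟨ power-of-one k Qʰ≈1 ⟩
          + 1                        ∎

      -- The rank is odd: for ρ = 2k, h is even, so t·k = h + 1 and t are odd,
      -- and Q ≡ μ^t ≡ (-Q^k)^t ≡ -Q^(h+1) ≡ -Q, impossible as Q ≢ 0.
      ρ-odd : Odd ρ
      ρ-odd = [ (λ ρ-even → ⊥-elim (even-rank-impossible ρ-even)) , (λ odd → odd) ]′ (parity ρ)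
        where
        even-rank-impossible : Even ρ → ⊥
        even-rank-impossible (k , ρ≡2k) = Q≉0 (≈-self-negation 2<p Q≈-Q)
          where
          h-even : Even h
          h-even = h-even-if-ρ-even k ρ≡2k
          t*k≡h+1 : t ℕ.* k ≡ suc h
          t*k≡h+1 = halve-product t k (suc h) (Eq.trans (cong (t ℕ.*_) (Eq.sym ρ≡2k)) (Eq.trans (Eq.sym p+1≡t*ρ) p+1≡[h+1]*2))
          t-odd : Odd t
          t-odd = [ (λ t-even → ⊥-elim (even∧odd⇒⊥ (subst Even t*k≡h+1 (even*any k t-even))
                                                     (proj₁ h-even , cong suc (proj₂ h-even))))
                  , (λ odd → odd) ]′ (parity t)
          μ≈-Qᵏ : μ ≈ - (Q ^ k)
          μ≈-Qᵏ = ≈-trans (≡⇒≈ (Eq.sym (ℤP.neg-involutive μ)))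
                    (neg-cong (≈-sym (half-rank k (Eq.trans (Eq.sym (double≡+ k)) (Eq.sym ρ≡2k)))))
          Q≈-Q : Q ≈ - Q
          Q≈-Q = begin
            Q                                 ≈⟨ μᵗ≈Q ⟨
            μ ^ t                             ≈⟨ ^-cong t μ≈-Qᵏ ⟩
            (- (Q ^ k)) ^ t                   ≡⟨ neg-power (Q ^ k) t ⟩
            (- + 1) ^ t * (Q ^ k) ^ t         ≡⟨ Eq.cong₂ _*_ (Eq.trans (cong ((- + 1) ^_) (proj₂ t-odd)) (-1^odd (proj₁ t-odd)))
                                                             (Eq.trans (ℤP.^-*-assoc Q k t) (cong (Q ^_) (Eq.trans (ℕP.*-comm k t) t*k≡h+1))) ⟩
            - + 1 * (Q * Q ^ h)               ≈⟨ *-congˡ (- + 1) (*-congˡ Q Qʰ≈1) ⟩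
            - + 1 * (Q * + 1)                 ≡⟨ lemma Q ⟩
            - Q                               ∎
            where lemma : ∀ Q → - + 1 * (Q * + 1) ≡ - Q
                  lemma = solve-∀

      -- t is even, as tρ = p + 1 is even and ρ is odd.
      t-even : Even t
      t-even = [ (λ even → even) , (λ t-odd → ⊥-elim (even∧odd⇒⊥ (suc h , p+1≡[h+1]*2)
                                                   (subst Odd (Eq.sym p+1≡t*ρ) (odd*odd t-odd ρ-odd)))) ]′ (parity t)

      -- h is odd: for h = 2j, Q^j ≡ μ^(tj) = (μʰ)^(t/2) ≡ 1, contradicting
      -- that Q has order o ≥ h > j.
      h-odd : Odd h
      h-odd = [ (λ h-even → ⊥-elim (even-h-impossible h-even)) , (λ odd → odd) ]′ (parity h)
        where
        even-h-impossible : Even h → ⊥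
        even-h-impossible (j , h≡2j) = proj₂ (proj₂ Q-order) j j>0 j<o (toCongruence Qʲ≈1)
          where
          j>0 : 0 ℕ.< j
          j>0 = ℕP.n≢0⇒n>0 λ j≡0 → ℕP.<⇒≢ 0<h (Eq.sym (Eq.trans h≡2j (cong (ℕ._* 2) j≡0)))
          j<o : j ℕ.< o
          j<o = ℕP.<-≤-trans (subst (j ℕ.<_) (Eq.sym (Eq.trans h≡2j (double≡+ j))) (ℕP.m<m+n j j>0)) h≤o
          t*j≡h*t′ : t ℕ.* j ≡ h ℕ.* proj₁ t-even
          t*j≡h*t′ = Eq.trans (cong (ℕ._* j) (proj₂ t-even))
                       (Eq.trans (swap-doubled (proj₁ t-even) j) (cong (ℕ._* proj₁ t-even) (Eq.sym h≡2j)))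
          Qʲ≈1 : Q ^ j ≈ + 1
          Qʲ≈1 = begin
            Q ^ j                        ≈⟨ ^-cong j μᵗ≈Q ⟨
            (μ ^ t) ^ j                  ≡⟨ ℤP.^-*-assoc μ t j ⟩
            μ ^ (t ℕ.* j)                ≡⟨ cong (μ ^_) t*j≡h*t′ ⟩
            μ ^ (h ℕ.* proj₁ t-even)     ≡⟨ ℤP.^-*-assoc μ h (proj₁ t-even) ⟨
            (μ ^ h) ^ proj₁ t-even       ≈⟨ power-of-one (proj₁ t-even) μʰ≈1 ⟩
            + 1                          ∎

module ResidueCounting where

  open PrimeModuli
  open NaturalNumbers
  open import Data.Nat as ℕ using (ℕ; zero; suc; z≤n)
  import Data.Nat.Properties as ℕP
  import Data.Nat.Divisibility as ℕD
  open import Data.Nat.Primality using (Prime)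
  open import Data.Integer as ℤ using (ℤ; +_; _+_; _*_; _-_; -_)
  open import Data.Product using (_,_; ∃)
  open import Data.Empty using (⊥-elim)
  open import Relation.Nullary using (¬_; Dec; yes; no)
  open import Relation.Binary.PropositionalEquality as Eq using (_≡_; refl; cong; subst)

  module Counting (p : ℕ) (p-prime : Prime p) where

    open PrimeModulus p p-prime

    -- [x ≡ r]: 1 if x ≡ r (mod p), else 0, decided as in the definition of
    -- occurrences.
    indicator : ℤ → ℤ → ℕ
    indicator x r with p ℕD.∣? ℤ.∣ x - r ∣
    ... | yes _ = 1
    ... | no _  = 0

    _≈?_ : ∀ x r → Dec (x ≈ r)
    x ≈? r with p ℕD.∣? ℤ.∣ x - r ∣
    ... | yes d = yes (fromCongruence d)
    ... | no ¬d = no (λ x≈r → ¬d (toCongruence x≈r))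

    indicator≤1 : ∀ x r → indicator x r ℕ.≤ 1
    indicator≤1 x r with p ℕD.∣? ℤ.∣ x - r ∣
    ... | yes _ = ℕP.≤-refl
    ... | no _  = z≤n

    indicator-yes : ∀ {x r} → x ≈ r → indicator x r ≡ 1
    indicator-yes {x} {r} x≈r with p ℕD.∣? ℤ.∣ x - r ∣
    ... | yes _ = refl
    ... | no ¬d = ⊥-elim (¬d (toCongruence x≈r))

    indicator-no : ∀ {x r} → ¬ x ≈ r → indicator x r ≡ 0
    indicator-no {x} {r} x≉r with p ℕD.∣? ℤ.∣ x - r ∣
    ... | yes d = ⊥-elim (x≉r (fromCongruence d))
    ... | no _  = refl

    indicator-positive : ∀ {x r} → 0 ℕ.< indicator x r → x ≈ r
    indicator-positive {x} {r} pos with x ≈? r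
    ... | yes x≈r = x≈r
    ... | no x≉r  = ⊥-elim (ℕP.<⇒≢ pos (Eq.sym (indicator-no x≉r)))

    indicator-cong : ∀ {x y} r → x ≈ y → indicator x r ≡ indicator y r
    indicator-cong {x} {y} r x≈y with x ≈? r
    ... | yes x≈r = Eq.trans (indicator-yes x≈r) (Eq.sym (indicator-yes (≈-trans (≈-sym x≈y) x≈r)))
    ... | no x≉r  = Eq.trans (indicator-no x≉r) (Eq.sym (indicator-no (λ y≈r → x≉r (≈-trans x≈y y≈r))))

    occurrences≡∑ : ∀ P Q r N → occurrences P Q p r N ≡ ∑[ i < N ] indicator (lucas P Q (suc i)) r
    occurrences≡∑ P Q r zero    = refl
    occurrences≡∑ P Q r (suc N) with p ℕD.∣? ℤ.∣ lucas P Q (suc N) - r ∣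
    ... | yes _ = cong suc (occurrences≡∑ P Q r N)
    ... | no _  = occurrences≡∑ P Q r N

    residue-count : ∀ {x} → ¬ x ≈ + 0 → ∑[ i < p ℕ.∸ 1 ] indicator x (+ suc i) ≡ 1
    residue-count {x} x≉0 = count (residue x) refl
      where
      count : ∀ v → residue x ≡ v → ∑[ i < p ℕ.∸ 1 ] indicator x (+ suc i) ≡ 1
      count zero    eq = ⊥-elim (x≉0 (subst (λ v → x ≈ + v) eq (≈residue x)))
      count (suc v) eq = ∑-single (p ℕ.∸ 1) v v<p-1 others (indicator-yes x≈1+v)
        where
        x≈1+v : x ≈ + suc v
        x≈1+v = subst (λ v → x ≈ + v) eq (≈residue x)
        1+v<p : suc v ℕ.< p
        1+v<p = subst (ℕ._< p) eq (residue<p x)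
        v<p-1 : v ℕ.< p ℕ.∸ 1
        v<p-1 = ℕP.∸-monoˡ-≤ 1 1+v<p
        others : ∀ i → i ℕ.< p ℕ.∸ 1 → i Eq.≢ v → indicator x (+ suc i) ≡ 0
        others i i<p-1 i≢v = indicator-no λ x≈1+i →
          i≢v (ℕP.suc-injective (small-injective (1+i<p i<p-1) 1+v<p
                                                  (≈-trans (≈-sym x≈1+i) x≈1+v)))

    occurring : ∀ P Q r N → 0 ℕ.< occurrences P Q p r N → ∃ λ n → lucas P Q n ≡ r [mod p ]
    occurring P Q r N pos with ∑-positive N _ (subst (0 ℕ.<_) (occurrences≡∑ P Q r N) pos)
    ... | i , _ , hit = suc i , toCongruence (indicator-positive hit)

    module Family (m : ℕ) (e : ℕ → ℤ) where

      hits : ℤ → ℕ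
      hits r = ∑[ q < m ] indicator (e q) r

      hits≤1 : (∀ {i j} → i ℕ.< j → j ℕ.< m → ¬ e i ≈ e j) → ∀ r → hits r ℕ.≤ 1
      hits≤1 distinct r = ∑-at-most-one m (λ q → indicator (e q) r) (λ q → indicator≤1 (e q) r)
        (λ a b a<b b<m ea≈r eb≈r → distinct a<b b<m
          (≈-trans (indicator-positive (ℕP.≤-reflexive (Eq.sym ea≈r))) (≈-sym (indicator-positive (ℕP.≤-reflexive (Eq.sym eb≈r))))))

      total-hits : (∀ q → q ℕ.< m → ¬ e q ≈ + 0) → ∑[ i < p ℕ.∸ 1 ] hits (+ suc i) ≡ m
      total-hits nonzero = begin
        ∑[ i < p ℕ.∸ 1 ] ∑[ q < m ] indicator (e q) (+ suc i)   ≡⟨ ∑-swap (p ℕ.∸ 1) m (λ i q → indicator (e q) (+ suc i)) ⟩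
        ∑[ q < m ] ∑[ i < p ℕ.∸ 1 ] indicator (e q) (+ suc i)   ≡⟨ ∑-cong m (λ q q<m → residue-count (nonzero q q<m)) ⟩
        ∑[ q < m ] 1                                              ≡⟨ ∑-const m 1 ⟩
        m ℕ.* 1                                                   ≡⟨ ℕP.*-identityʳ m ⟩
        m                                                         ∎
        where open Eq.≡-Reasoning

    complete-from-distribution : ∀ {P Q π z w} → Distribution P Q p π z w → 0 ℕ.< z → 0 ℕ.< w → IsComplete P Q p
    complete-from-distribution {P} {Q} {π} (zeros , nonzeros) z>0 w>0 r = hit (residue r) refl
      where
      count : ∀ v → v ℕ.< p → 0 ℕ.< occurrences P Q p (+ v) π
      count zero    _   = subst (0 ℕ.<_) (Eq.sym zeros) z>0
      count (suc v) v<p = subst (0 ℕ.<_) (Eq.sym (nonzeros (suc v) ℕ.z<s v<p)) w>0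
      hit : ∀ v → residue r ≡ v → ∃ λ n → lucas P Q n ≡ r [mod p ]
      hit v eq with occurring P Q (+ v) π (count v (subst (ℕ._< p) eq (residue<p r)))
      ... | n , Fn≡v = n , toCongruence (≈-trans (fromCongruence {lucas P Q n} {+ v} Fn≡v) (≈-sym (subst (λ v → r ≈ + v) eq (≈residue r))))

module PeriodDistribution where

  open PrimeModuli
  open FermatAndEuler
  open LucasSequences
  open NaturalNumbers
  open OrdersAndRanks
  open Periods
  open ResidueCounting
  open import Data.Nat as ℕ using (ℕ; zero; suc; s≤s)
  import Data.Nat.Properties as ℕP
  open import Data.Nat.Primality using (Prime)
  open import Data.Integer as ℤ using (ℤ; +_; _+_; _*_; _-_; -_; _^_)
  import Data.Integer.Properties as ℤP
  open import Data.Product using (_,_; proj₁; proj₂)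
  open import Data.Sum using (_⊎_; inj₁; inj₂; [_,_]′)
  open import Data.Empty using (⊥-elim)
  open import Relation.Nullary using (¬_; Dec; yes; no)
  open import Relation.Binary.PropositionalEquality as Eq using (_≡_; refl; cong; subst)

  -- Counting the residues in one period: writing the period as s blocks
  -- F(j + qρ) ≡ μ^q F(j), 0 < j ≤ ρ, each block contributes one zero, and a
  -- nonzero r is counted by the orbits {μ^q F(j) : q < s} that contain it.
  module PeriodCounts (p : ℕ) (p-prime : Prime p) (h : ℕ) (p≡2h+1 : p ≡ suc (h ℕ.+ h))
                      (P Q : ℤ) (D-nonresidue : IsQuadNonResidue (P * P - + 4 * Q) p)
                      (o : ℕ) (Q-order : IsMultOrder Q p o) (h≤o : h ℕ.≤ o)
                      (ρ : ℕ) (ρ-rank : IsRankOfApparition P Q p ρ)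
                      (π : ℕ) (π-period : IsPisanoPeriod P Q p π) where

    open PrimeModulus p p-prime
    open MultiplicativeOrder p p-prime using (powers-distinct)
    open LucasIdentities P Q using (F)
    open PeriodAtPrime p p-prime h p≡2h+1 P Q D-nonresidue o Q-order h≤o ρ ρ-rank π π-period
    open Counting p p-prime

    ρ-1 : ℕ
    ρ-1 = ρ ℕ.∸ 1

    ρ≡1+[ρ-1] : ρ ≡ suc ρ-1
    ρ≡1+[ρ-1] = Eq.sym (ℕP.suc-pred ρ {{ℕ.>-nonZero ρ>0}})

    F-nonzero-before-ρ : ∀ j → j ℕ.< ρ-1 → ¬ F (suc j) ≈ + 0
    F-nonzero-before-ρ j j<ρ-1 = F-nonzero-below-ρ (suc j) ℕ.z<s (subst (suc j ℕ.<_) (Eq.sym ρ≡1+[ρ-1]) (s≤s j<ρ-1))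

    module Orbit (c : ℤ) = Counting.Family p p-prime s (λ q → μ ^ q * c)

    orbit-nonzero : ∀ {c} → ¬ c ≈ + 0 → ∀ q → ¬ μ ^ q * c ≈ + 0
    orbit-nonzero c≉0 q = nonzero-* (nonzero-^ q μ≉0) c≉0

    period-sum : ∀ r → occurrences P Q p r π ≡ ∑[ q < s ] ∑[ j < ρ ] indicator (μ ^ q * F (suc j)) r
    period-sum r = begin
      occurrences P Q p r π                                    ≡⟨ occurrences≡∑ P Q r π ⟩
      ∑[ i < π ] indicator (F (suc i)) r                       ≡⟨ cong (λ n → ∑[ i < n ] indicator (F (suc i)) r) π≡s*ρ ⟩
      ∑[ i < s ℕ.* ρ ] indicator (F (suc i)) r                 ≡⟨ ∑-blocks s ρ (λ i → indicator (F (suc i)) r) ⟩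
      ∑[ q < s ] ∑[ j < ρ ] indicator (F (suc j ℕ.+ q ℕ.* ρ)) r ≡⟨ ∑-cong s (λ q _ → ∑-cong ρ (λ j _ → indicator-cong r (shift-by-blocks q (suc j)))) ⟩
      ∑[ q < s ] ∑[ j < ρ ] indicator (μ ^ q * F (suc j)) r    ∎
      where open Eq.≡-Reasoning

    -- Each block has exactly one zero, at its end.
    zero-count : occurrences P Q p (+ 0) π ≡ s
    zero-count = begin
      occurrences P Q p (+ 0) π                                   ≡⟨ period-sum (+ 0) ⟩
      ∑[ q < s ] ∑[ j < ρ ] indicator (μ ^ q * F (suc j)) (+ 0)   ≡⟨ ∑-cong s (λ q _ → one-zero q) ⟩
      ∑[ q < s ] 1                                                ≡⟨ ∑-const s 1 ⟩
      s ℕ.* 1                                                     ≡⟨ ℕP.*-identityʳ s ⟩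
      s                                                           ∎
      where
      open Eq.≡-Reasoning
      one-zero : ∀ q → ∑[ j < ρ ] indicator (μ ^ q * F (suc j)) (+ 0) ≡ 1
      one-zero q = ∑-single ρ ρ-1 (subst (ρ-1 ℕ.<_) (Eq.sym ρ≡1+[ρ-1]) ℕP.≤-refl)
        (λ j j<ρ j≢ρ-1 → indicator-no (orbit-nonzero (F-nonzero-before-ρ j (ℕP.≤∧≢⇒< (ℕP.≤-pred (subst (suc j ℕ.≤_) ρ≡1+[ρ-1] j<ρ)) j≢ρ-1)) q))
        (indicator-yes (≈-trans (*-congˡ (μ ^ q) (subst (λ n → F n ≈ + 0) ρ≡1+[ρ-1] F[ρ]≈0)) (≡⇒≈ (ℤP.*-zeroʳ (μ ^ q)))))

    nonzero-count : ∀ {r} → ¬ r ≈ + 0 → occurrences P Q p r π ≡ ∑[ j < ρ-1 ] Orbit.hits (F (suc j)) r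
    nonzero-count {r} r≉0 = begin
      occurrences P Q p r π                                      ≡⟨ period-sum r ⟩
      ∑[ q < s ] ∑[ j < ρ ] indicator (μ ^ q * F (suc j)) r      ≡⟨ ∑-cong s (λ q _ → drop-zero q) ⟩
      ∑[ q < s ] ∑[ j < ρ-1 ] indicator (μ ^ q * F (suc j)) r    ≡⟨ ∑-swap s ρ-1 (λ q j → indicator (μ ^ q * F (suc j)) r) ⟩
      ∑[ j < ρ-1 ] ∑[ q < s ] indicator (μ ^ q * F (suc j)) r    ∎
      where
      open Eq.≡-Reasoning
      drop-zero : ∀ q → ∑[ j < ρ ] indicator (μ ^ q * F (suc j)) r ≡ ∑[ j < ρ-1 ] indicator (μ ^ q * F (suc j)) r
      drop-zero q = Eq.trans (cong (λ n → ∑[ j < n ] indicator (μ ^ q * F (suc j)) r) ρ≡1+[ρ-1])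
                             (cong (ℕ._+ ∑[ j < ρ-1 ] indicator (μ ^ q * F (suc j)) r) (indicator-no μᵠF[ρ]≉r))
        where
        μᵠF[ρ]≉r : ¬ μ ^ q * F (suc ρ-1) ≈ r
        μᵠF[ρ]≉r μᵠF[ρ]≈r = r≉0 (≈-trans (≈-sym μᵠF[ρ]≈r)
          (≈-trans (*-congˡ (μ ^ q) (subst (λ n → F n ≈ + 0) ρ≡1+[ρ-1] F[ρ]≈0)) (≡⇒≈ (ℤP.*-zeroʳ (μ ^ q)))))

    -- μ is a primitive root when s = p - 1: every orbit of a nonzero c meets
    -- every nonzero class exactly once, so each nonzero r occurs ρ - 1 times.
    module PrimitiveRoot (s≡p-1 : s ≡ p ℕ.∸ 1) where

      orbit-hits-once : ∀ {c} → ¬ c ≈ + 0 → ∀ i → i ℕ.< p ℕ.∸ 1 → Orbit.hits c (+ suc i) ≡ 1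
      orbit-hits-once {c} c≉0 = ∑-all-one (p ℕ.∸ 1) (λ i → Orbit.hits c (+ suc i))
        (λ i → Orbit.hits≤1 c (powers-distinct μ-order c≉0) (+ suc i))
        (Eq.trans (Orbit.total-hits c (λ q _ → orbit-nonzero c≉0 q)) s≡p-1)

      distribution : Distribution P Q p π (p ℕ.∸ 1) (ρ ℕ.∸ 1)
      distribution = Eq.trans zero-count s≡p-1 , nonzero
        where
        nonzero : ∀ r → 0 ℕ.< r → r ℕ.< p → occurrences P Q p (+ r) π ≡ ρ-1
        nonzero (suc i) _ r<p = begin
          occurrences P Q p (+ suc i) π                 ≡⟨ nonzero-count (small-nonzero ℕ.z<s r<p) ⟩
          ∑[ j < ρ-1 ] Orbit.hits (F (suc j)) (+ suc i) ≡⟨ ∑-cong ρ-1 (λ j j<ρ-1 → orbit-hits-once (F-nonzero-before-ρ j j<ρ-1) i i<p-1) ⟩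
          ∑[ j < ρ-1 ] 1                                ≡⟨ ∑-const ρ-1 1 ⟩
          ρ-1 ℕ.* 1                                     ≡⟨ ℕP.*-identityʳ ρ-1 ⟩
          ρ-1                                           ∎
          where open Eq.≡-Reasoning
                i<p-1 : i ℕ.< p ℕ.∸ 1
                i<p-1 = ℕP.∸-monoˡ-≤ 1 r<p

    -- When s = h (so h and ρ are odd), μ generates the squares.  With the
    -- quadratic character χ(x) = xʰ ≡ ±1, the orbit of a nonzero c meets r
    -- exactly when χ(c) ≡ χ(r), and reflection pairs F(j) with F(ρ - j),
    -- which have opposite characters; so each nonzero r occurs (ρ-1)/2 times.
    module HalfOrderCounts (s≡h : s ≡ h) where

      open HalfOrder s≡h using (μʰ≈1; Qʰ≈1; ρ-odd; h-odd)
      open EulerCriterion p p-prime h p≡2h+1 using (power-h²; 2<p)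
      open OddModulus 2<p using (≈-self-negation)
      open MultiplicativeOrder p p-prime using (power-of-one)

      χ : ℤ → ℤ
      χ x = x ^ h

      χ-sign : ∀ {x} → ¬ x ≈ + 0 → χ x ≈ + 1 ⊎ χ x ≈ - + 1
      χ-sign x≉0 = square≈1 (power-h² x≉0)

      χ-nonzero : ∀ {x} → ¬ x ≈ + 0 → ¬ χ x ≈ + 0
      χ-nonzero = nonzero-^ h

      χ-invariant : ∀ {a} → a ^ h ≈ + 1 → ∀ q c → χ (a ^ q * c) ≈ χ c
      χ-invariant {a} aʰ≈1 q c = ≈-trans (≡⇒≈ (Eq.trans (^-*-distribʳ (a ^ q) c h) (cong (_* χ c) (^-*-comm a q h))))
                                   (≈-trans (*-congʳ (χ c) (power-of-one q aʰ≈1)) (≡⇒≈ (ℤP.*-identityˡ (χ c))))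

      χ-odd : ∀ x → χ (- x) ≡ - χ x
      χ-odd x = Eq.trans (neg-power x h) (Eq.trans (cong (_* χ x) (Eq.trans (cong ((- + 1) ^_) (proj₂ h-odd)) (-1^odd (proj₁ h-odd))))
                                                    (ℤP.-1*i≡-i (χ x)))

      module NegatedOrbit (c : ℤ) = Counting.Family p p-prime s (λ q → - (μ ^ q * c))

      orbit-character : ∀ {c r} → 0 ℕ.< Orbit.hits c r → χ c ≈ χ r
      orbit-character {c} {r} pos with ∑-positive s _ pos
      ... | q , _ , hit = ≈-trans (≈-sym (χ-invariant μʰ≈1 q c)) (^-cong h (indicator-positive hit))

      negated-orbit-character : ∀ {c r} → 0 ℕ.< NegatedOrbit.hits c r → χ r ≈ - χ c
      negated-orbit-character {c} {r} pos with ∑-positive s _ pos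
      ... | q , _ , hit = ≈-trans (^-cong h (≈-sym (indicator-positive hit)))
                            (≈-trans (≡⇒≈ (χ-odd (μ ^ q * c))) (neg-cong (χ-invariant μʰ≈1 q c)))

      -- Together the orbit and the negated orbit of a nonzero c meet each
      -- nonzero class exactly once: at most once each, not both (the
      -- characters differ), and 2s = p - 1 times in total.
      orbits-hit-once : ∀ {c} → ¬ c ≈ + 0 → ∀ i → i ℕ.< p ℕ.∸ 1 →
                        Orbit.hits c (+ suc i) ℕ.+ NegatedOrbit.hits c (+ suc i) ≡ 1
      orbits-hit-once {c} c≉0 = ∑-all-one (p ℕ.∸ 1) (λ i → Orbit.hits c (+ suc i) ℕ.+ NegatedOrbit.hits c (+ suc i)) bound total
        where
        bound : ∀ i → Orbit.hits c (+ suc i) ℕ.+ NegatedOrbit.hits c (+ suc i) ℕ.≤ 1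
        bound i = exclusive-sum≤1 (Orbit.hits≤1 c (powers-distinct μ-order c≉0) (+ suc i))
                    (NegatedOrbit.hits≤1 c (λ i<j j<s -x≈-y → powers-distinct μ-order c≉0 i<j j<s (neg-injective -x≈-y)) (+ suc i))
                    (λ pos neg-pos → χ-nonzero c≉0 (≈-self-negation (≈-trans (orbit-character pos) (negated-orbit-character neg-pos))))
        total : ∑[ i < p ℕ.∸ 1 ] (Orbit.hits c (+ suc i) ℕ.+ NegatedOrbit.hits c (+ suc i)) ≡ p ℕ.∸ 1
        total = begin
          ∑[ i < p ℕ.∸ 1 ] (Orbit.hits c (+ suc i) ℕ.+ NegatedOrbit.hits c (+ suc i))   ≡⟨ ∑-+ (p ℕ.∸ 1) _ _ ⟩
          ∑[ i < p ℕ.∸ 1 ] Orbit.hits c (+ suc i) ℕ.+ ∑[ i < p ℕ.∸ 1 ] NegatedOrbit.hits c (+ suc i)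
            ≡⟨ Eq.cong₂ ℕ._+_ (Orbit.total-hits c (λ q _ → orbit-nonzero c≉0 q)) (NegatedOrbit.total-hits c (λ q _ → nonzero-neg (orbit-nonzero c≉0 q))) ⟩
          s ℕ.+ s                                                                        ≡⟨ Eq.cong₂ ℕ._+_ s≡h s≡h ⟩
          h ℕ.+ h                                                                        ≡⟨ cong ℕ.pred p≡2h+1 ⟨
          p ℕ.∸ 1                                                                        ∎
          where open Eq.≡-Reasoning

      orbit-hits : ∀ {c} → ¬ c ≈ + 0 → ∀ i → i ℕ.< p ℕ.∸ 1 → Orbit.hits c (+ suc i) ≡ indicator (χ c) (χ (+ suc i))
      orbit-hits {c} c≉0 i i<p-1 with χ c ≈? χ (+ suc i)
      ... | yes χc≈χr = Eq.trans (Eq.trans (Eq.sym (ℕP.+-identityʳ _)) (Eq.trans (cong (Orbit.hits c (+ suc i) ℕ.+_) (Eq.sym missed))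
                                     (orbits-hit-once c≉0 i i<p-1))) (Eq.sym (indicator-yes χc≈χr))
        where
        missed : NegatedOrbit.hits c (+ suc i) ≡ 0
        missed with NegatedOrbit.hits c (+ suc i) in eq
        ... | zero  = refl
        ... | suc _ = ⊥-elim (χ-nonzero (small-nonzero ℕ.z<s (1+i<p i<p-1))
                        (≈-self-negation (≈-trans (negated-orbit-character (subst (0 ℕ.<_) (Eq.sym eq) ℕ.z<s)) (neg-cong (χc≈χr)))))
      ... | no χc≉χr  = Eq.trans missed (Eq.sym (indicator-no χc≉χr))
        where
        missed : Orbit.hits c (+ suc i) ≡ 0
        missed with Orbit.hits c (+ suc i) in eq
        ... | zero  = refl
        ... | suc _ = ⊥-elim (χc≉χr (orbit-character (subst (0 ℕ.<_) (Eq.sym eq) ℕ.z<s)))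

      reflected-character : ∀ j k → k ℕ.+ j ≡ ρ → χ (F k) ≈ - χ (F j)
      reflected-character j k k+j≡ρ = begin
        χ (F k)                 ≈⟨ χ-invariant Qʰ≈1 j (F k) ⟨
        χ (Q ^ j * F k)         ≈⟨ ^-cong h (reflection-at-ρ j k k+j≡ρ) ⟩
        χ (- (μ * F j))         ≡⟨ χ-odd (μ * F j) ⟩
        - χ (μ * F j)           ≡⟨ cong (λ x → - χ (x * F j)) (ℤP.*-identityʳ μ) ⟨
        - χ (μ ^ 1 * F j)       ≈⟨ neg-cong (χ-invariant μʰ≈1 1 (F j)) ⟩
        - χ (F j)               ∎
        where open ≈-Reasoning

      opposite-signs : ∀ {y R} → (y ≈ + 1 ⊎ y ≈ - + 1) → (R ≈ + 1 ⊎ R ≈ - + 1) → ¬ y ≈ R → y ≈ - R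
      opposite-signs (inj₁ y≈1)  (inj₁ R≈1)  y≉R = ⊥-elim (y≉R (≈-trans y≈1 (≈-sym R≈1)))
      opposite-signs (inj₁ y≈1)  (inj₂ R≈-1) _   = ≈-trans y≈1 (neg-injective (≈-trans (≈-sym R≈-1) (≡⇒≈ (Eq.sym (ℤP.neg-involutive _)))))
      opposite-signs (inj₂ y≈-1) (inj₁ R≈1)  _   = ≈-trans y≈-1 (neg-cong (≈-sym R≈1))
      opposite-signs (inj₂ y≈-1) (inj₂ R≈-1) y≉R = ⊥-elim (y≉R (≈-trans y≈-1 (≈-sym R≈-1)))

      paired : ∀ {R} → (R ≈ + 1 ⊎ R ≈ - + 1) → ∀ j → j ℕ.< ρ-1 →
               indicator (χ (F (suc j))) R ℕ.+ indicator (χ (F (suc (ρ-1 ℕ.∸ suc j)))) R ≡ 1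
      paired {R} R≈±1 j j<ρ-1 = pick (χ (F (suc j)) ≈? R)
        where
        R≉0 : ¬ R ≈ + 0
        R≉0 R≈0 = [ (λ R≈1 → 1≉0 (≈-trans (≈-sym R≈1) R≈0)) , (λ R≈-1 → 1≉0 (neg-injective (≈-trans (≈-sym R≈-1) R≈0))) ]′ R≈±1
        z≈-y : χ (F (suc (ρ-1 ℕ.∸ suc j))) ≈ - χ (F (suc j))
        z≈-y = reflected-character (suc j) (suc (ρ-1 ℕ.∸ suc j))
                 (Eq.trans (cong suc (ℕP.m∸n+n≡m j<ρ-1)) (Eq.sym ρ≡1+[ρ-1]))
        pick : Dec (χ (F (suc j)) ≈ R) →
               indicator (χ (F (suc j))) R ℕ.+ indicator (χ (F (suc (ρ-1 ℕ.∸ suc j)))) R ≡ 1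
        pick (yes y≈R) = Eq.cong₂ ℕ._+_ (indicator-yes y≈R) (indicator-no (λ z≈R → R≉0 (≈-self-negation
                           (≈-trans (≈-sym z≈R) (≈-trans z≈-y (neg-cong y≈R))))))
        pick (no y≉R)  = Eq.cong₂ ℕ._+_ (indicator-no y≉R) (indicator-yes (≈-trans z≈-y
                           (≈-trans (neg-cong (opposite-signs (χ-sign (F-nonzero-before-ρ j j<ρ-1)) R≈±1 y≉R))
                                    (≡⇒≈ (ℤP.neg-involutive R)))))

      distribution : Distribution P Q p π ((p ℕ.∸ 1) ℕ./ 2) ((ρ ℕ.∸ 1) ℕ./ 2)
      distribution = Eq.trans zero-count (Eq.trans s≡h (Eq.sym (half p-1≡h*2))) , nonzero
        where
        p-1≡h*2 : p ℕ.∸ 1 ≡ h ℕ.* 2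
        p-1≡h*2 = Eq.trans (cong ℕ.pred p≡2h+1) (Eq.sym (double≡+ h))
        nonzero : ∀ r → 0 ℕ.< r → r ℕ.< p → occurrences P Q p (+ r) π ≡ ρ-1 ℕ./ 2
        nonzero (suc i) _ r<p = Eq.trans occurrences≡S (Eq.sym (half ρ-1≡S*2))
          where
          S : ℕ
          S = ∑[ j < ρ-1 ] indicator (χ (F (suc j))) (χ (+ suc i))
          occurrences≡S : occurrences P Q p (+ suc i) π ≡ S
          occurrences≡S = Eq.trans (nonzero-count (small-nonzero ℕ.z<s r<p))
            (∑-cong ρ-1 (λ j j<ρ-1 → orbit-hits (F-nonzero-before-ρ j j<ρ-1) i (ℕP.∸-monoˡ-≤ 1 r<p)))
          ρ-1≡S*2 : ρ-1 ≡ S ℕ.* 2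
          ρ-1≡S*2 = Eq.trans (Eq.sym (∑-paired ρ-1 _ (paired (χ-sign (small-nonzero ℕ.z<s r<p))))) (Eq.sym (double≡+ S))

module MainResult where

  open PrimeModuli
  open FermatAndEuler
  open NaturalNumbers
  open Periods
  open ResidueCounting
  open PeriodDistribution
  open import Data.Nat using (ℕ; _∸_; _/_; _%_; _<_)
  import Data.Nat as ℕ
  import Data.Nat.Properties as ℕP
  import Data.Nat.DivMod as ℕDM
  open import Data.Nat.Solver using (module +-*-Solver)
  open import Data.Integer.Tactic.RingSolver using (solve-∀)
  import Data.Sum
  open import Data.Nat.Primality using (Prime)
  open import Data.Integer as ℤ using (ℤ; +_)
  open import Data.Product using (_×_; _,_; proj₁; proj₂; ∃)
  open import Data.Sum using (_⊎_; inj₁; inj₂)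
  open import Data.Empty using (⊥-elim)
  open import Relation.Binary.PropositionalEquality as Eq using (_≡_; refl; cong; subst)
  open import Relation.Nullary using (¬_)

  module Conclusion (P Q : ℤ) (p : ℕ) (p-prime : Prime p) (p-odd : p % 2 ≡ 1)
                    (P≢0 : ¬ (P ≡ + 0 [mod p ])) (D-nonresidue : IsQuadNonResidue (P ℤ.* P ℤ.- + 4 ℤ.* Q) p)
                    (Q-order : IsMultOrder Q p ((p ∸ 1) / 1) ⊎ IsMultOrder Q p ((p ∸ 1) / 2))
                    (π ρ : ℕ) (π-period : IsPisanoPeriod P Q p π) (ρ-rank : IsRankOfApparition P Q p ρ) where

    open PrimeModulus p p-prime

    h : ℕ
    h = p / 2

    p≡2h+1 : p ≡ ℕ.suc (h ℕ.+ h)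
    p≡2h+1 = Eq.trans (ℕDM.m≡m%n+[m/n]*n p 2) (Eq.trans (cong (ℕ._+ h ℕ.* 2) p-odd) (cong ℕ.suc (double≡+ h)))

    p-1≡h+h : p ∸ 1 ≡ h ℕ.+ h
    p-1≡h+h = cong ℕ.pred p≡2h+1

    p-1≡h*2 : p ∸ 1 ≡ h ℕ.* 2
    p-1≡h*2 = Eq.trans p-1≡h+h (Eq.sym (double≡+ h))

    order-at-least-h : IsMultOrder Q p ((p ∸ 1) / 1) ⊎ IsMultOrder Q p ((p ∸ 1) / 2) →
                       ∃ λ o → IsMultOrder Q p o × h ℕ.≤ o
    order-at-least-h (inj₁ order) = _ , order , ℕP.≤-trans (ℕP.m≤m+n h h)
                                      (ℕP.≤-reflexive (Eq.sym (Eq.trans (ℕDM.n/1≡n (p ∸ 1)) p-1≡h+h)))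
    order-at-least-h (inj₂ order) = _ , order , ℕP.≤-reflexive (Eq.sym (half p-1≡h*2))

    o : ℕ
    o = proj₁ (order-at-least-h Q-order)

    o-order : IsMultOrder Q p o
    o-order = proj₁ (proj₂ (order-at-least-h Q-order))

    h≤o : h ℕ.≤ o
    h≤o = proj₂ (proj₂ (order-at-least-h Q-order))

    open PeriodAtPrime p p-prime h p≡2h+1 P Q D-nonresidue o o-order h≤o ρ ρ-rank π π-period
    open PeriodCounts p p-prime h p≡2h+1 P Q D-nonresidue o o-order h≤o ρ ρ-rank π π-period
    open Counting p p-prime using (complete-from-distribution)
    open EulerCriterion p p-prime h p≡2h+1 using (0<h)

    DistributionA DistributionB : Set
    DistributionA = Distribution P Q p π (p ∸ 1) (ρ ∸ 1)
    DistributionB = Distribution P Q p π ((p ∸ 1) / 2) ((ρ ∸ 1) / 2)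

    outcome : DistributionA ⊎ (Odd h × Odd ρ × DistributionB)
    outcome = by-order s-cases
      where
      by-order : s ≡ h ℕ.+ h ⊎ s ≡ h → DistributionA ⊎ (Odd h × Odd ρ × DistributionB)
      by-order (inj₁ s≡2h) = inj₁ (PrimitiveRoot.distribution (Eq.trans s≡2h (Eq.sym p-1≡h+h)))
      by-order (inj₂ s≡h)  = inj₂ (HalfOrder.h-odd s≡h , HalfOrder.ρ-odd s≡h , HalfOrderCounts.distribution s≡h)

    -- ρ ≥ 3, as F(1) = 1 and F(2) = P are nonzero.
    ρ≥3 : 3 ℕ.≤ ρ
    ρ≥3 = at-least-3 ρ refl
      where
      F[2]≡P : lucas P Q 2 ≡ P
      F[2]≡P = lemma P Q
        where lemma : ∀ P Q → P ℤ.* + 1 ℤ.- Q ℤ.* + 0 ≡ P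
              lemma = solve-∀
      at-least-3 : ∀ n → ρ ≡ n → 3 ℕ.≤ ρ
      at-least-3 0 ρ≡0 = ⊥-elim (ℕP.<⇒≢ ρ>0 (Eq.sym ρ≡0))
      at-least-3 1 ρ≡1 = ⊥-elim (1≉0 (subst (λ n → lucas P Q n ≈ + 0) ρ≡1 F[ρ]≈0))
      at-least-3 2 ρ≡2 = ⊥-elim (P≢0 (toCongruence (≈-trans (≡⇒≈ (Eq.sym F[2]≡P)) (subst (λ n → lucas P Q n ≈ + 0) ρ≡2 F[ρ]≈0))))
      at-least-3 (ℕ.suc (ℕ.suc (ℕ.suc n))) ρ≡3+n = subst (3 ℕ.≤_) (Eq.sym ρ≡3+n) (ℕ.s≤s (ℕ.s≤s (ℕ.s≤s ℕ.z≤n)))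

    -- Both distributions count every class a positive number of times.
    complete : IsComplete P Q p
    complete = by-case outcome
      where
      by-case : DistributionA ⊎ (Odd h × Odd ρ × DistributionB) → IsComplete P Q p
      by-case (inj₁ distribution) =
        complete-from-distribution {P} {Q} {π} distribution (ℕP.∸-monoˡ-≤ 1 1<p) (ℕP.∸-monoˡ-≤ 1 (ℕP.≤-trans (ℕP.n≤1+n 2) ρ≥3))
      by-case (inj₂ (_ , (k , ρ≡1+2k) , distribution)) =
        complete-from-distribution {P} {Q} {π} distribution (subst (0 ℕ.<_) (Eq.sym (half p-1≡h*2)) 0<h)
                                                (subst (0 ℕ.<_) (Eq.sym (half (cong ℕ.pred ρ≡1+2k))) k>0)
        where
        k>0 : 0 ℕ.< k
        k>0 = ℕP.n≢0⇒n>0 λ k≡0 → ℕP.<⇒≱ (subst (ℕ._< 3) (Eq.sym (Eq.trans ρ≡1+2k (cong (λ k → ℕ.suc (k ℕ.* 2)) k≡0))) (ℕ.s≤s (ℕ.s≤s ℕ.z≤n))) ρ≥3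

    h-odd⇒p≡3 : Odd h → p % 4 ≡ 3
    h-odd⇒p≡3 (j , h≡1+2j) = Eq.trans (cong (_% 4) p≡3+4j) (ℕDM.[m+kn]%n≡m%n 3 j 4)
      where
      p≡3+4j : p ≡ 3 ℕ.+ j ℕ.* 4
      p≡3+4j = Eq.trans p≡2h+1 (Eq.trans (cong (λ h → ℕ.suc (h ℕ.+ h)) h≡1+2j)
                 (solve 1 (λ j → con 1 :+ ((con 1 :+ j :* con 2) :+ (con 1 :+ j :* con 2)) := con 3 :+ j :* con 4) refl j))
        where open +-*-Solver using (solve; _:+_; _:*_; _:=_; con)

    ρ-odd⇒ρ≡1 : Odd ρ → ρ % 2 ≡ 1
    ρ-odd⇒ρ≡1 (k , ρ≡1+2k) = Eq.trans (cong (_% 2) ρ≡1+2k) (ℕDM.[m+kn]%n≡m%n 1 k 2)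

    -- (a): case (b)(ii) needs p ≡ 3 (mod 4) and ρ odd.
    part-a : p % 4 ≡ 1 ⊎ (p % 4 ≡ 3 × ρ % 2 ≡ 0) → DistributionA
    part-a = by-case outcome
      where
      by-case : DistributionA ⊎ (Odd h × Odd ρ × DistributionB) → p % 4 ≡ 1 ⊎ (p % 4 ≡ 3 × ρ % 2 ≡ 0) → DistributionA
      by-case (inj₁ distribution) _ = distribution
      by-case (inj₂ (h-odd , _ , _)) (inj₁ p≡1) with Eq.trans (Eq.sym p≡1) (h-odd⇒p≡3 h-odd)
      ... | ()
      by-case (inj₂ (_ , ρ-odd , _)) (inj₂ (_ , ρ≡0)) with Eq.trans (Eq.sym ρ≡0) (ρ-odd⇒ρ≡1 ρ-odd)
      ... | ()

    part-b : p % 4 ≡ 3 × ρ % 2 ≡ 1 → DistributionA ⊎ DistributionB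
    part-b _ = Data.Sum.map₂ (λ { (_ , _ , distribution) → distribution }) outcome


open import Data.Nat using (ℕ; _∸_; _/_; _%_; _<_)
open import Data.Nat.Primality using (Prime)
open import Data.Integer as ℤ using (ℤ; +_)
open import Data.Product using (_×_; _,_)
open import Data.Sum using (_⊎_)
open import Relation.Binary.PropositionalEquality using (_≡_)
open import Relation.Nullary using (¬_)
open MainResult

theorem3 : (P Q : ℤ) (p : ℕ) → Prime p → p % 2 ≡ 1 →
    ¬ (P ≡ + 0 [mod p ]) →
    IsQuadNonResidue (P ℤ.* P ℤ.- + 4 ℤ.* Q) p →
    (IsMultOrder Q p ((p ∸ 1) / 1) ⊎ IsMultOrder Q p ((p ∸ 1) / 2)) →
    (π ρ : ℕ) → IsPisanoPeriod P Q p π → IsRankOfApparition P Q p ρ →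
    IsComplete P Q p
    × ((p % 4 ≡ 1 ⊎ (p % 4 ≡ 3 × ρ % 2 ≡ 0)) →
        Distribution P Q p π (p ∸ 1) (ρ ∸ 1))
    × ((p % 4 ≡ 3 × ρ % 2 ≡ 1) →
        Distribution P Q p π (p ∸ 1) (ρ ∸ 1)
        ⊎ Distribution P Q p π ((p ∸ 1) / 2) ((ρ ∸ 1) / 2))
theorem3 P Q p p-prime p-odd P≢0 D-nonresidue Q-order π ρ π-period ρ-rank = complete , part-a , part-b
  where open Conclusion P Q p p-prime p-odd P≢0 D-nonresidue Q-order π ρ π-period ρ-rank
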